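{- Let $G$ be a finite graph which is the union of two graphs $K$ and $H$ that have disjoint edge sets and share exactly the vertices $U=V(K)\cap V(H)=\{u_1,\ldots,u_n\}$. Let $t$ be a real number, and let $B_n(t)=\big(b_{\mathcal{A}\mathcal{B}}(t)\big)_{\mathcal{A},\mathcal{B}\in\Gamma(U)}$ be any real matrix satisfying $$T_n(t)\,B_n(t)\,T_n(t)=T_n(t).$$ Then, for all $x,y$, $$f(G;t,x,y)=\sum_{\mathcal{A},\mathcal{B}\in\Gamma(U)} b_{\mathcal{A}\mathcal{B}}(t)\, f(K/\mathcal{A};t,x,y)\, f(H/\mathcal{B};t,x,y).$$
   Context: Graphs are finite and may have loops and multiple edges. A spanning subgraph $A\subseteq G$ is a subgraph with $V(A)=V(G)$ (determined by a subset of edges); $\omega(A)$ is its number of connected components. The Negami polynomial is $$f(G;t,x,y)=\sum_{A\subseteq G,\ V(A)=V(G)} t^{\omega(A)}x^{|E(A)|}y^{|E(G)|-|E(A)|}.$$ $\Gamma(U)$ is the set of partitions of $U$, partially ordered by $\gamma\le\gamma'$ iff $\gamma'$ is a refinement of $\gamma$; for partitions $\mathcal{A},\mathcal{B}$, $\mathcal{A}\wedge\mathcal{B}$ denotes their infimum in this order (the finest partition of which both $\mathcal{A}$ and $\mathcal{B}$ are refinements), and $|\gamma|$ denotes the number of blocks of $\gamma$. $T_n(t)$ is the $|\Gamma(U)|\times|\Gamma(U)|$ matrix indexed by $\Gamma(U)$ whose $(\mathcal{A},\mathcal{B})$ entry is $t^{|\mathcal{A}\wedge\mathcal{B}|}$.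 For $\mathcal{A}=\{U_1,\ldots,U_k\}\in\Gamma(U)$, $K/\mathcal{A}$ (resp. $H/\mathcal{A}$) is the graph obtained from $K$ (resp. $H$) by identifying all vertices in each block $U_i$ into a single vertex (all edges are kept). -}

module Defs where

open import Level using (Level)
open import Data.Nat using (ℕ; zero; suc; _+_; _<ᵇ_; _≡ᵇ_)
open import Data.Fin using (Fin; toℕ; fromℕ; inject₁; _↑ˡ_; _↑ʳ_; splitAt)
open import Data.Bool using (Bool; true; false; _∧_; _∨_; not; if_then_else_)
open import Data.List using (List; []; _∷_; _++_; map; concatMap; length; filterᵇ; foldr; allFin)
open import Data.Bool.ListAction using (any)
open import Data.List.Base using (lookup)
open import Data.Vec using (Vec; []; _∷_)
import Data.Vec as Vec
open import Data.Product using (Σ; _×_; _,_; proj₁; proj₂)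
open import Data.Sum using (inj₁; inj₂)
open import Algebra.Bundles using (CommutativeRing)

-- Graphs (finite, loops and multiple edges allowed).
-- A graph on vertex set Fin m is a list of edges; each list entry is one
-- edge (so repeated entries are parallel edges, (v , v) is a loop).

Graph : ℕ → Set
Graph m = List (Fin m × Fin m)

_==_ : ∀ {m} → Fin m → Fin m → Bool
u == v = toℕ u ≡ᵇ toℕ v

reach : ∀ {m} → Graph m → ℕ → Fin m → Fin m → Bool
reach es zero    u v = u == v
reach es (suc i) u v =
  reach es i u v ∨
  any (λ e → (reach es i u (proj₁ e) ∧ (proj₂ e == v))
           ∨ (reach es i u (proj₂ e) ∧ (proj₁ e == v))) es

connected : ∀ {m} → Graph m → Fin m → Fin m → Bool
connected {m} es u v = reach es m u v

-- number of connected components = number of vertices that are the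
-- least vertex (in the order of Fin m) of their component
ω : ∀ {m} → Graph m → ℕ
ω {m} es =
  length (filterᵇ (λ v → not (any (λ u → (toℕ u <ᵇ toℕ v) ∧ connected es u v)
                                 (allFin m)))
                 (allFin m))

-- all edge subsets, as selection vectors
subsets : (k : ℕ) → List (Vec Bool k)
subsets zero    = [] ∷ []
subsets (suc k) = map (true ∷_) (subsets k) ++ map (false ∷_) (subsets k)

select : ∀ {A : Set} → (es : List A) → Vec Bool (length es) → List A
select []       []          = []
select (e ∷ es) (true ∷ s)  = e ∷ select es s
select (e ∷ es) (false ∷ s) = select es s

countTrue countFalse : ∀ {k} → Vec Bool k → ℕ
countTrue  s = Vec.count (λ b → Data.Bool._≟_ b true) s
countFalse s = Vec.count (λ b → Data.Bool._≟_ b false) s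

-- contraction of a graph along a vertex map (all edges are kept)
contract : ∀ {m m'} → Graph m → (Fin m → Fin m') → Graph m'
contract es φ = map (λ e → φ (proj₁ e) , φ (proj₂ e)) es

-- A partition is (p , ℓ) with p = number of blocks and ℓ : Vec (Fin p) n
-- the block label of each element, in a canonical form; parts n lists
-- every partition of Fin n exactly once.  (New element 0 either opens
-- a new block, labelled p, or joins an existing block j < p.)

Part : ℕ → Set
Part n = Σ ℕ (λ p → Vec (Fin p) n)

parts : (n : ℕ) → List (Part n)
parts zero    = (0 , []) ∷ []
parts (suc n) = concatMap ext (parts n)
  where
  ext : Part n → List (Part (suc n))
  ext (p , ℓ) = (suc p , fromℕ p ∷ Vec.map inject₁ ℓ)
              ∷ map (λ j → p , j ∷ ℓ) (allFin p)

record Γ (n : ℕ) : Set where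
  constructor ⟨_⟩
  field idx : Fin (length (parts n))

part : ∀ {n} → Γ n → Part n
part {n} ⟨ i ⟩ = lookup (parts n) i

blocks : ∀ {n} → Γ n → ℕ
blocks i = proj₁ (part i)

label : ∀ {n} (i : Γ n) → Fin n → Fin (blocks i)
label i u = Vec.lookup (proj₂ (part i)) u

-- |𝒜 ∧ ℬ| : blocks of the infimum (finest common coarsening) = components
-- of the graph on U joining elements in the same block of 𝒜 or of ℬ
meetSize : ∀ {n} → Γ n → Γ n → ℕ
meetSize {n} 𝒜 ℬ =
  ω (concatMap (λ i → concatMap (λ j →
        if (label 𝒜 i == label 𝒜 j) ∨ (label ℬ i == label ℬ j)
        then (i , j) ∷ [] else []) (allFin n)) (allFin n))

-- Gluing K (on U ∪ {k extra vertices}) and H (on U ∪ {h extra vertices})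
-- along U: vertices of K are Fin (n + k), those of H are Fin (n + h), the
-- first n being u_1..u_n in both.

embK : ∀ n k h → Fin (n + k) → Fin (n + (k + h))
embK n k h v with splitAt n v
... | inj₁ i = (i ↑ˡ (k + h))
... | inj₂ j = (n ↑ʳ (j ↑ˡ h))

embH : ∀ n k h → Fin (n + h) → Fin (n + (k + h))
embH n k h v with splitAt n v
... | inj₁ i = (i ↑ˡ (k + h))
... | inj₂ j = (n ↑ʳ (k ↑ʳ j))

glue : ∀ n k h → Graph (n + k) → Graph (n + h) → Graph (n + (k + h))
glue n k h K H = contract K (embK n k h) ++ contract H (embH n k h)

quotientMap : ∀ n k (𝒜 : Γ n) → Fin (n + k) → Fin (blocks 𝒜 + k)
quotientMap n k 𝒜 v with splitAt n v
... | inj₁ i = (label 𝒜 i ↑ˡ k)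
... | inj₂ j = (blocks 𝒜 ↑ʳ j)

_/_ : ∀ {n k} → Graph (n + k) → (𝒜 : Γ n) → Graph (blocks 𝒜 + k)
_/_ {n} {k} X 𝒜 = contract X (quotientMap n k 𝒜)

module Poly {c ℓ : Level} (R : CommutativeRing c ℓ) where
  open CommutativeRing R renaming (_+_ to _⊕_; _*_ to _⊛_)

  pow : Carrier → ℕ → Carrier
  pow a zero    = 1#
  pow a (suc k) = a ⊛ pow a k

  sumL : List Carrier → Carrier
  sumL = foldr _⊕_ 0#

  ΣΓ : ∀ {n} → (Γ n → Carrier) → Carrier
  ΣΓ {n} g = sumL (map (λ i → g ⟨ i ⟩) (allFin (length (parts n))))

  negami : ∀ {m} → Graph m → Carrier → Carrier → Carrier → Carrier
  negami es t x y =
    sumL (map (λ s → pow t (ω (select es s)) ⊛ pow x (countTrue s)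
                       ⊛ pow y (countFalse s))
              (subsets (length es)))

  T : ∀ n → Carrier → Γ n → Γ n → Carrier
  T n t 𝒜 ℬ = pow t (meetSize 𝒜 ℬ)

  triple : ∀ {n} → (Γ n → Γ n → Carrier) → (Γ n → Γ n → Carrier)
         → (Γ n → Γ n → Carrier) → Γ n → Γ n → Carrier
  triple M₁ M₂ M₃ 𝒜 ℬ = ΣΓ (λ 𝒞 → ΣΓ (λ 𝒟 → M₁ 𝒜 𝒞 ⊛ M₂ 𝒞 𝒟 ⊛ M₃ 𝒟 ℬ))

-- Expand f(G) as a sum over edge sets S = S_K ∪ S_H; apart from x^|S| y^|E ∖ S|, which
-- factorises, a summand is t^ω(S). Let π_K, π_H be the partitions of U induced by
-- connectivity in S_K, S_H and a_K, a_H the numbers of components of S_K, S_H avoiding U.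
-- Then ω(S) = |π_K ∧ π_H| + a_K + a_H and ω(S_K/𝒜) = |π_K ∧ 𝒜| + a_K, ω(S_H/ℬ) = |ℬ ∧ π_H| + a_H,
-- so the (π_K, π_H) entry of T B T = T reads t^ω(S) = Σ b_𝒜ℬ t^ω(S_K/𝒜) t^ω(S_H/ℬ);
-- summing over S_K and S_H independently gives the theorem.
-- Components are counted by their least vertices. As U comes first, a component meeting U
-- is counted at a vertex of U, where connectivity is the meet of the partitions involved.

module Submission where

open import Defs
open import Data.Bool using (Bool; true; false; T; not; _∧_; _∨_; if_then_else_)
import Data.Bool.Properties as Bool
open import Data.Bool.Properties using (T-∧; T-∨; ∧-identityʳ)
open import Data.Bool.ListAction using (any)
import Data.Bool.ListAction as ListAction
open import Data.Empty using (⊥; ⊥-elim)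
open import Data.Fin using (Fin; toℕ; _↑ˡ_; _↑ʳ_; fromℕ<; splitAt; fromℕ; inject₁; lower₁) renaming (zero to fzero; suc to fsuc)
open import Data.Fin.Properties using (toℕ-↑ˡ; toℕ-↑ʳ; toℕ<n; ¬∀⟶∃¬-smallest; toℕ-injective; suc-injective; toℕ-inject; toℕ-fromℕ<; splitAt⁻¹-↑ˡ; splitAt⁻¹-↑ʳ; splitAt-↑ˡ; splitAt-↑ʳ; ↑ˡ-injective; all?; any?; ¬∀⟶∃¬; toℕ-fromℕ; inject₁-lower₁; fromℕ≢inject₁; inject₁-injective; 0≢1+n; _≟_)
open import Data.List using (List; []; _∷_; _++_; map; length; filterᵇ; tabulate; allFin; concatMap)
open import Data.List.Properties using (map-cong; map-tabulate; map-++; map-∘)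
open import Data.List.Membership.Propositional using (_∈_; find; lose)
open import Data.List.Membership.Propositional.Properties using (∈-allFin; ∈-concatMap⁻; ∈-concatMap⁺; ∈-map⁻; ∈-map⁺; ∈-lookup; ∈-++⁻; ∈-++⁺ˡ; ∈-++⁺ʳ)
open import Data.List.Relation.Unary.Any using (here; there; index)
open import Data.List.Relation.Unary.Any.Properties using (any⇔; lookup-index)
import Data.Nat as ℕ
open import Data.Nat using (ℕ; zero; suc; _+_; _≤_; _<_; _≤′_; ≤′-reflexive; ≤′-step; z≤n; s≤s; _<ᵇ_; _≡ᵇ_)
open import Data.Nat.Properties
  using (≤-trans; <-trans; <-≤-trans; ≤-antisym; <-asym; n≤1+n; n<1+n; ≤-pred; ≤⇒≤′; +-monoʳ-<; +-cancelˡ-<; m≤m+n; <-irrefl; <-cmp; <ᵇ⇒<; <⇒<ᵇ; ≡ᵇ⇒≡; ≡⇒≡ᵇ)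
open import Data.Vec using ([]; _∷_)
import Data.Vec as Vec
open import Data.Vec.Properties using (lookup-map)
open import Data.Product using (Σ; ∃; ∃₂; _×_; _,_; proj₁; proj₂)
open import Data.Sum using (_⊎_; inj₁; inj₂)
import Data.Sum
open import Function using (_∘_; _∘₂_; _⇔_; mk⇔; Equivalence)
open import Function.Construct.Composition using (_⇔-∘_)
open import Function.Construct.Symmetry using (⇔-sym)
open import Relation.Binary.Definitions using (tri<; tri≈; tri>)
open import Relation.Binary.Structures using (IsEquivalence)
import Relation.Binary.Construct.On as On
open import Relation.Binary.Bundles using (Setoid)
import Relation.Binary.Reasoning.Setoid as SetoidReasoning
open import Algebra.Bundles using (CommutativeRing)
open import Relation.Binary.Construct.Closure.Equivalence as EqClosure using (EqClosure)
open import Relation.Binary.Construct.Closure.ReflexiveTransitive using (Star; ε; _◅_; _◅◅_)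
open import Relation.Binary.Construct.Closure.Symmetric using (SymClosure; fwd; bwd)
open import Relation.Binary.PropositionalEquality
  using (_≡_; _≢_; refl; sym; trans; cong; cong₂; subst; subst₂; module ≡-Reasoning)
open import Relation.Nullary using (¬_; yes; no; does)
open import Relation.Nullary.Decidable using (T?; ¬?; decidable-stable)

private
  variable
    m m' n r : ℕ

T-ext : ∀ {a b} → (T a → T b) → (T b → T a) → a ≡ b
T-ext {true}  {true}  _ _ = refl
T-ext {true}  {false} f _ = ⊥-elim (f _)
T-ext {false} {true}  _ g = ⊥-elim (g _)
T-ext {false} {false} _ _ = refl

T-not : ∀ {a} → T (not a) ⇔ (¬ T a)
T-not {true}  = mk⇔ (λ ()) (λ ¬t → ¬t _)
T-not {false} = mk⇔ (λ _ ()) (λ _ → _)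

≡ᵇ-⇔ : ∀ {u v : Fin m} → T (toℕ u ≡ᵇ toℕ v) ⇔ (u ≡ v)
≡ᵇ-⇔ {u = u} {v} =
  mk⇔ (toℕ-injective ∘ ≡ᵇ⇒≡ (toℕ u) (toℕ v)) (≡⇒≡ᵇ (toℕ u) (toℕ v) ∘ cong toℕ)

count : (Fin m → Bool) → ℕ
count {zero}  P = 0
count {suc m} P = if P fzero then suc (count (P ∘ fsuc)) else count (P ∘ fsuc)

length-filterᵇ-tabulate : ∀ {A : Set} (P : A → Bool) (f : Fin m → A) →
  length (filterᵇ P (tabulate f)) ≡ count (P ∘ f)
length-filterᵇ-tabulate {zero}  P f = refl
length-filterᵇ-tabulate {suc m} P f with P (f fzero)
... | true  = cong suc (length-filterᵇ-tabulate P (f ∘ fsuc))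
... | false = length-filterᵇ-tabulate P (f ∘ fsuc)

count-cong : {P Q : Fin m → Bool} → (∀ i → P i ≡ Q i) → count P ≡ count Q
count-cong {zero}  eq = refl
count-cong {suc m} {P} {Q} eq rewrite eq fzero = cong (λ c → if Q fzero then suc c else c) (count-cong (eq ∘ fsuc))

count-↑ : ∀ n r (P : Fin (n + r) → Bool) →
  count P ≡ count (λ i → P (i ↑ˡ r)) + count (λ j → P (n ↑ʳ j))
count-↑ zero    r P = refl
count-↑ (suc n) r P with P fzero
... | true  = cong suc (count-↑ n r (P ∘ fsuc))
... | false = count-↑ n r (P ∘ fsuc)

count≤ : (P : Fin m → Bool) → count P ≤ m
count≤ {zero}  P = z≤n
count≤ {suc m} P with P fzero
... | true  = s≤s (count≤ (P ∘ fsuc))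
... | false = ≤-trans (count≤ (P ∘ fsuc)) (n≤1+n m)

≢⇒T-not-≟ : ∀ (i j : Fin m) → i ≢ j → T (not (does (i ≟ j)))
≢⇒T-not-≟ i j i≢j with i ≟ j
... | yes i≡j = i≢j i≡j
... | no  _   = _

count-remove : (Q : Fin m → Bool) (w : Fin m) → T (Q w) →
  count Q ≡ suc (count (λ v → Q v ∧ not (does (v ≟ w))))
count-remove {suc m} Q fzero q with Q fzero
... | true  = cong suc (count-cong (λ v → sym (∧-identityʳ (Q (fsuc v)))))
... | false = ⊥-elim q
count-remove {suc m} Q (fsuc w) q with Q fzero | count-remove (Q ∘ fsuc) w q
... | true  | eq = cong suc eq
... | false | eq = eq

count-injection : (P : Fin m → Bool) (Q : Fin m' → Bool) (f : Fin m → Fin m') →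
  (∀ i → T (P i) → T (Q (f i))) →
  (∀ i j → T (P i) → T (P j) → f i ≡ f j → i ≡ j) →
  count P ≤ count Q
count-injection {zero}  P Q f maps inj = z≤n
count-injection {suc m} P Q f maps inj with P fzero in eq
... | false = count-injection (P ∘ fsuc) Q (f ∘ fsuc) (maps ∘ fsuc) (λ i j p q → suc-injective ∘ inj _ _ p q)
... | true  = subst (suc (count (P ∘ fsuc)) ≤_) (sym (count-remove Q (f fzero) (maps fzero p₀)))
                (s≤s (count-injection (P ∘ fsuc) _ (f ∘ fsuc) maps′ (λ i j p q → suc-injective ∘ inj _ _ p q)))
  where
  p₀ : T (P fzero)
  p₀ = subst T (sym eq) _
  maps′ : ∀ i → T (P (fsuc i)) → T (Q (f (fsuc i)) ∧ not (does (f (fsuc i) ≟ f fzero)))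
  maps′ i p = Equivalence.from T-∧ (maps (fsuc i) p , ≢⇒T-not-≟ (f (fsuc i)) (f fzero) (0≢1+n ∘ inj _ _ p₀ p ∘ sym))

count-< : {P Q : Fin m → Bool} → (∀ i → T (P i) → T (Q i)) →
  ∀ v → ¬ T (P v) → T (Q v) → count P < count Q
count-< {P = P} {Q} P⊆Q v ¬p q = subst (count P <_) (sym (count-remove Q v q))
  (s≤s (count-injection P _ (λ i → i) (λ i p → Equivalence.from T-∧ (P⊆Q i p , ≢⇒T-not-≟ i v λ { refl → ¬p p }))
                        (λ _ _ _ _ i≡j → i≡j)))

-- Equivalence classes, counted by their least elements

Dominated : (Fin m → Fin m → Bool) → Fin m → Set
Dominated R v = ∃ λ u → toℕ u < toℕ v × T (R u v)

-- Literally the predicate filtered in the definition of ω.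
isLeader : (Fin m → Fin m → Bool) → Fin m → Bool
isLeader {m} R v = not (any (λ u → (toℕ u <ᵇ toℕ v) ∧ R u v) (allFin m))

classes : (Fin m → Fin m → Bool) → ℕ
classes R = count (isLeader R)

ω≡classes : (es : Graph m) → ω es ≡ classes (connected es)
ω≡classes es = length-filterᵇ-tabulate (isLeader (connected es)) (λ v → v)

isLeader-⇔ : ∀ (R : Fin m → Fin m → Bool) v → T (isLeader R v) ⇔ (¬ Dominated R v)
isLeader-⇔ {m} R v = mk⇔ (λ l d → Equivalence.to T-not l (from d)) (λ ¬d → Equivalence.from T-not (¬d ∘ to))
  where
  p : Fin m → Bool
  p u = (toℕ u <ᵇ toℕ v) ∧ R u v
  to : T (any p (allFin m)) → Dominated R v
  to t with find (Equivalence.from (any⇔ {xs = allFin m}) t)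
  ... | u , _ , pu with Equivalence.to T-∧ pu
  ... | u<v , r = u , <ᵇ⇒< (toℕ u) (toℕ v) u<v , r
  from : Dominated R v → T (any p (allFin m))
  from (u , u<v , r) = Equivalence.to any⇔ (lose (∈-allFin u) (Equivalence.from T-∧ (<⇒<ᵇ u<v , r)))

isLeader-cong : ∀ (R : Fin m → Fin m → Bool) (R′ : Fin m' → Fin m' → Bool) v v′ →
  (Dominated R v → Dominated R′ v′) → (Dominated R′ v′ → Dominated R v) →
  isLeader R v ≡ isLeader R′ v′
isLeader-cong R R′ v v′ f g = T-ext
  (λ l → Equivalence.from (isLeader-⇔ R′ v′) (Equivalence.to (isLeader-⇔ R v) l ∘ g))
  (λ l → Equivalence.from (isLeader-⇔ R v) (Equivalence.to (isLeader-⇔ R′ v′) l ∘ f))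

classes-cong : (R R′ : Fin m → Fin m → Bool) → (∀ u v → T (R u v) ⇔ T (R′ u v)) → classes R ≡ classes R′
classes-cong R R′ R⇔R′ = count-cong λ v → isLeader-cong R R′ v v
  (λ (u , u<v , r) → u , u<v , Equivalence.to (R⇔R′ u v) r)
  (λ (u , u<v , r) → u , u<v , Equivalence.from (R⇔R′ u v) r)

module Classes (R : Fin m → Fin m → Bool) (R-equiv : IsEquivalence (T ∘₂ R)) where
  private module R = IsEquivalence R-equiv

  leaders-related⇒≡ : ∀ {a b} → T (isLeader R a) → T (isLeader R b) → T (R a b) → a ≡ b
  leaders-related⇒≡ {a} {b} la lb r with <-cmp (toℕ a) (toℕ b)
  ... | tri< a<b _ _ = ⊥-elim (Equivalence.to (isLeader-⇔ R b) lb (a , a<b , r))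
  ... | tri≈ _ a≡b _ = toℕ-injective a≡b
  ... | tri> _ _ b<a = ⊥-elim (Equivalence.to (isLeader-⇔ R a) la (b , b<a , R.sym r))

  leaderOf : ∀ c → ∃ λ w → T (R w c) × T (isLeader R w)
  leaderOf c with ¬∀⟶∃¬-smallest m (λ u → ¬ T (R u c)) (λ u → ¬? (T? (R u c))) (λ ¬r → ¬r c R.refl)
  ... | w , ¬¬r , minimal = w , rw , Equivalence.from (isLeader-⇔ R w)
        λ (u , u<w , r) → below u u<w (R.trans r rw)
    where
    rw : T (R w c)
    rw = decidable-stable (T? (R w c)) ¬¬r
    below : ∀ u → toℕ u < toℕ w → ¬ T (R u c)
    below u u<w = subst (λ x → ¬ T (R x c))
      (toℕ-injective (trans (toℕ-inject (fromℕ< u<w)) (toℕ-fromℕ< u<w))) (minimal (fromℕ< u<w))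


classes-pullback : (R : Fin m → Fin m → Bool) → IsEquivalence (T ∘₂ R) →
  (φ : Fin m' → Fin m) → (∀ w → ∃ λ u → T (R w (φ u))) →
  classes (λ u v → R (φ u) (φ v)) ≡ classes R
classes-pullback {m} {m'} R R-equiv φ φ-onto = ≤-antisym
  (count-injection _ _ f (λ v _ → proj₂ (proj₂ (leaderOf (φ v)))) f-injective)
  (count-injection _ _ g (λ w _ → proj₂ (proj₂ (leaderOf′ (proj₁ (φ-onto w))))) g-injective)
  where
  module R = IsEquivalence R-equiv
  R′ : Fin m' → Fin m' → Bool
  R′ u v = R (φ u) (φ v)
  R′-equiv : IsEquivalence (T ∘₂ R′)
  R′-equiv = On.isEquivalence φ R-equiv
  leaderOf : ∀ c → ∃ λ w → T (R w c) × T (isLeader R w)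
  leaderOf = Classes.leaderOf R R-equiv
  leaderOf′ : ∀ c → ∃ λ w → T (R′ w c) × T (isLeader R′ w)
  leaderOf′ = Classes.leaderOf R′ R′-equiv

  f : Fin m' → Fin m
  f v = proj₁ (leaderOf (φ v))
  f-related : ∀ v → T (R (φ v) (f v))
  f-related v = R.sym (proj₁ (proj₂ (leaderOf (φ v))))
  f-injective : ∀ u v → T (isLeader R′ u) → T (isLeader R′ v) → f u ≡ f v → u ≡ v
  f-injective u v lu lv fu≡fv = Classes.leaders-related⇒≡ R′ R′-equiv lu lv
    (R.trans (f-related u) (subst (λ w → T (R w (φ v))) (sym fu≡fv) (R.sym (f-related v))))

  g : Fin m → Fin m'
  g w = proj₁ (leaderOf′ (proj₁ (φ-onto w)))
  g-related : ∀ w → T (R w (φ (g w)))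
  g-related w = R.trans (proj₂ (φ-onto w)) (R.sym (proj₁ (proj₂ (leaderOf′ (proj₁ (φ-onto w))))))
  g-injective : ∀ w w′ → T (isLeader R w) → T (isLeader R w′) → g w ≡ g w′ → w ≡ w′
  g-injective w w′ lw lw′ gw≡gw′ = Classes.leaders-related⇒≡ R R-equiv lw lw′
    (R.trans (g-related w) (subst (λ u → T (R (φ u) w′)) (sym gw≡gw′) (R.sym (g-related w′))))

data SplitAt (n r : ℕ) : Fin (n + r) → Set where
  left  : ∀ i → SplitAt n r (i ↑ˡ r)
  right : ∀ j → SplitAt n r (n ↑ʳ j)

splitAt-view : ∀ n r v → SplitAt n r v
splitAt-view n r v with splitAt n v in eq
... | inj₁ i = subst (SplitAt n r) (splitAt⁻¹-↑ˡ eq) (left i)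
... | inj₂ j = subst (SplitAt n r) (splitAt⁻¹-↑ʳ eq) (right j)

↑ˡ<↑ʳ : ∀ (i : Fin n) (j : Fin r) → toℕ (i ↑ˡ r) < toℕ (n ↑ʳ j)
↑ˡ<↑ʳ {n} {r} i j = subst₂ _<_ (sym (toℕ-↑ˡ i r)) (sym (toℕ-↑ʳ n j)) (<-≤-trans (toℕ<n i) (m≤m+n n (toℕ j)))

↑ˡ≢↑ʳ : ∀ (i : Fin n) (j : Fin r) → i ↑ˡ r ≢ n ↑ʳ j
↑ˡ≢↑ʳ i j eq = <-irrefl (cong toℕ eq) (↑ˡ<↑ʳ i j)

classes-↑ : ∀ n r (R : Fin (n + r) → Fin (n + r) → Bool) →
  classes R ≡ classes (λ i j → R (i ↑ˡ r) (j ↑ˡ r)) + count (λ j → isLeader R (n ↑ʳ j))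
classes-↑ n r R =
  trans (count-↑ n r (isLeader R)) (cong (_+ count (λ j → isLeader R (n ↑ʳ j)))
    (count-cong λ i → isLeader-cong R R↾ (i ↑ˡ r) i (down i) (up i)))
  where
  R↾ : Fin n → Fin n → Bool
  R↾ i j = R (i ↑ˡ r) (j ↑ˡ r)
  down : ∀ i → Dominated R (i ↑ˡ r) → Dominated R↾ i
  down i (u , u<i , rui) with splitAt-view n r u
  ... | left i′ = i′ , subst₂ _<_ (toℕ-↑ˡ i′ r) (toℕ-↑ˡ i r) u<i , rui
  ... | right j = ⊥-elim (<-asym u<i (↑ˡ<↑ʳ i j))
  up : ∀ i → Dominated R↾ i → Dominated R (i ↑ˡ r)
  up i (i′ , i′<i , r′) = i′ ↑ˡ r , subst₂ _<_ (sym (toℕ-↑ˡ i′ r)) (sym (toℕ-↑ˡ i r)) i′<i , r′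

-- Connectivity

Edge : Graph m → Fin m → Fin m → Set
Edge es u v = (u , v) ∈ es

Connected : Graph m → Fin m → Fin m → Set
Connected es = EqClosure (Edge es)

module Reach (es : Graph m) (u : Fin m) where

  LastEdge : ℕ → Fin m → Set
  LastEdge i v = ∃ λ a → T (reach es i u a) × SymClosure (Edge es) a v

  reach-suc⇔ : ∀ i v → T (reach es (suc i) u v) ⇔ (T (reach es i u v) ⊎ LastEdge i v)
  reach-suc⇔ i v = mk⇔ to from
    where
    to : T (reach es (suc i) u v) → T (reach es i u v) ⊎ LastEdge i v
    to t with Equivalence.to T-∨ t
    ... | inj₁ r = inj₁ r
    ... | inj₂ r with find (Equivalence.from (any⇔ {xs = es}) r)
    ... | (a , b) , ab∈es , test with Equivalence.to T-∨ test
    ...   | inj₁ forward with Equivalence.to T-∧ forward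
    ...     | ra , b≡v = inj₂ (a , ra , fwd (subst (λ w → (a , w) ∈ es) (Equivalence.to ≡ᵇ-⇔ b≡v) ab∈es))
    to t | inj₂ r | (a , b) , ab∈es , test | inj₂ backward with Equivalence.to T-∧ backward
    ...     | rb , a≡v = inj₂ (b , rb , bwd (subst (λ w → (w , b) ∈ es) (Equivalence.to ≡ᵇ-⇔ a≡v) ab∈es))
    from : T (reach es i u v) ⊎ LastEdge i v → T (reach es (suc i) u v)
    from (inj₁ r) = Equivalence.from (T-∨ {reach es i u v}) (inj₁ r)
    from (inj₂ (a , r , fwd av∈es)) = Equivalence.from (T-∨ {reach es i u v}) (inj₂ (Equivalence.to any⇔
      (lose av∈es (Equivalence.from T-∨ (inj₁ (Equivalence.from T-∧ (r , Equivalence.from (≡ᵇ-⇔ {u = v}) refl)))))))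
    from (inj₂ (a , r , bwd va∈es)) = Equivalence.from (T-∨ {reach es i u v}) (inj₂ (Equivalence.to any⇔
      (lose va∈es (Equivalence.from (T-∨ {reach es i u v ∧ (a == v)})
        (inj₂ (Equivalence.from T-∧ (r , Equivalence.from (≡ᵇ-⇔ {u = v}) refl)))))))

  reach-suc : ∀ i v → T (reach es i u v) → T (reach es (suc i) u v)
  reach-suc i v = Equivalence.from (reach-suc⇔ i v) ∘ inj₁

  reach⇒Connected : ∀ i {v} → T (reach es i u v) → Connected es u v
  reach⇒Connected zero    {v} t rewrite Equivalence.to (≡ᵇ-⇔ {u = u} {v}) t = ε
  reach⇒Connected (suc i) {v} t with Equivalence.to (reach-suc⇔ i v) t
  ... | inj₁ r           = reach⇒Connected i r
  ... | inj₂ (a , r , s) = reach⇒Connected i r ◅◅ (s ◅ ε)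

  Connected⇒reach : ∀ {v} → Connected es u v → ∃ λ i → T (reach es i u v)
  Connected⇒reach = extend 0 (Equivalence.from (≡ᵇ-⇔ {u = u}) refl)
    where
    extend : ∀ i {a b} → T (reach es i u a) → Star (SymClosure (Edge es)) a b → ∃ λ j → T (reach es j u b)
    extend i r ε        = i , r
    extend i r (s ◅ ss) = extend (suc i) (Equivalence.from (reach-suc⇔ i _) (inj₂ (_ , r , s))) ss

  reach-mono : ∀ {i j} v → i ≤ j → T (reach es i u v) → T (reach es j u v)
  reach-mono v = mono′ ∘ ≤⇒≤′
    where
    mono′ : ∀ {i j} → i ≤′ j → T (reach es i u v) → T (reach es j u v)
    mono′ (≤′-reflexive refl) = λ r → r
    mono′ (≤′-step {j} i≤′j)  = reach-suc j v ∘ mono′ i≤′j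

  Stable : ℕ → Set
  Stable i = ∀ v → reach es (suc i) u v ≡ reach es i u v

  reach-suc-cong : ∀ i j → (∀ v → reach es i u v ≡ reach es j u v) →
    ∀ v → reach es (suc i) u v ≡ reach es (suc j) u v
  reach-suc-cong i j same v = cong₂ _∨_ (same v)
    (cong ListAction.or (map-cong (λ e → cong₂ _∨_ (cong (_∧ _) (same (proj₁ e))) (cong (_∧ _) (same (proj₂ e)))) es))

  stable-forever : ∀ {i} → Stable i → ∀ d v → reach es (d + i) u v ≡ reach es i u v
  stable-forever st zero    v = refl
  stable-forever {i} st (suc d) v = trans (reach-suc-cong (d + i) i (stable-forever st d) v) (st v)

  -- Until the reachable set stabilises it gains a vertex at every step.
  grows-or-stabilises : ∀ j → (∃ λ i → i < j × Stable i) ⊎ (j ≤ count (λ v → reach es j u v))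
  grows-or-stabilises zero = inj₂ z≤n
  grows-or-stabilises (suc j) with grows-or-stabilises j
  ... | inj₁ (i , i<j , st) = inj₁ (i , <-trans i<j (n<1+n j) , st)
  ... | inj₂ j≤count with all? (λ v → reach es (suc j) u v Bool.≟ reach es j u v)
  ...   | yes st = inj₁ (j , n<1+n j , st)
  ...   | no ¬st with ¬∀⟶∃¬ m _ (λ v → reach es (suc j) u v Bool.≟ reach es j u v) ¬st
  ...     | v , changed = inj₂ (<-≤-trans (s≤s j≤count) (count-< (reach-suc j) v old new))
    where
    old : ¬ T (reach es j u v)
    old r = changed (T-ext (λ _ → r) (reach-suc j v))
    new : T (reach es (suc j) u v)
    new = decidable-stable (T? _) (λ ¬new → changed (T-ext (⊥-elim ∘ ¬new) (⊥-elim ∘ old)))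

  stabilises : ∃ λ i → i ≤ m × Stable i
  stabilises with grows-or-stabilises (suc m)
  ... | inj₁ (i , i<1+m , st) = i , ≤-pred i<1+m , st
  ... | inj₂ 1+m≤count        = ⊥-elim (<-irrefl refl (<-≤-trans 1+m≤count (count≤ _)))

  reach⇒connected : ∀ j v → T (reach es j u v) → T (connected es u v)
  reach⇒connected j v r with stabilises
  ... | i , i≤m , st = reach-mono v i≤m (subst T (stable-forever st j v) (reach-mono v (m≤m+n j i) r))

connected⇔Connected : (es : Graph m) → ∀ u v → T (connected es u v) ⇔ Connected es u v
connected⇔Connected {m} es u v = mk⇔ (reach⇒Connected m) (λ c → reach⇒connected (proj₁ (Connected⇒reach c)) v (proj₂ (Connected⇒reach c)))
  where open Reach es u

connected⇒Connected : ∀ {es : Graph m} {u v} → T (connected es u v) → Connected es u v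
connected⇒Connected = Equivalence.to (connected⇔Connected _ _ _)

Connected⇒connected : ∀ {es : Graph m} {u v} → Connected es u v → T (connected es u v)
Connected⇒connected = Equivalence.from (connected⇔Connected _ _ _)

connected-isEquivalence : (es : Graph m) → IsEquivalence (T ∘₂ connected es)
connected-isEquivalence es = record
  { refl  = Connected⇒connected (EqClosure.reflexive (Edge es))
  ; sym   = λ c → Connected⇒connected (EqClosure.symmetric (Edge es) (connected⇒Connected c))
  ; trans = λ c d → Connected⇒connected (EqClosure.transitive (Edge es) (connected⇒Connected c) (connected⇒Connected d))
  }

-- Partitions and their meet

SameBlock : Γ n → Fin n → Fin n → Set
SameBlock 𝒜 i j = label 𝒜 i ≡ label 𝒜 j

LabelsOnto : Part n → Set
LabelsOnto (p , ℓ) = ∀ (b : Fin p) → ∃ λ i → Vec.lookup ℓ i ≡ b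

parts-labels-onto : ∀ n {x} → x ∈ parts n → LabelsOnto x
parts-labels-onto zero    (here refl) ()
parts-labels-onto (suc n) x∈ with find (∈-concatMap⁻ _ {xs = parts n} x∈)
... | (p , ℓ) , y∈ , here refl = onto
  where
  onto : ∀ b → ∃ λ i → Vec.lookup (fromℕ p ∷ Vec.map inject₁ ℓ) i ≡ b
  onto b with toℕ b ℕ.≟ p
  ... | yes b≡p = fzero , toℕ-injective (trans (toℕ-fromℕ p) (sym b≡p))
  ... | no  b≢p with parts-labels-onto n y∈ (lower₁ b (b≢p ∘ sym))
  ...   | i , ℓi≡b = fsuc i , trans (lookup-map i inject₁ ℓ) (trans (cong inject₁ ℓi≡b) (inject₁-lower₁ b (b≢p ∘ sym)))
... | (p , ℓ) , y∈ , there x∈′ with ∈-map⁻ _ x∈′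
...   | j , _ , refl = λ b → let (i , ℓi≡b) = parts-labels-onto n y∈ b in fsuc i , ℓi≡b

label-onto : (𝒜 : Γ n) (b : Fin (blocks 𝒜)) → ∃ λ i → label 𝒜 i ≡ b
label-onto {n} ⟨ i ⟩ = parts-labels-onto n (∈-lookup i)

parts-realise : ∀ n (E : Fin n → Fin n → Bool) → IsEquivalence (T ∘₂ E) →
  ∃ λ x → x ∈ parts n × (∀ i j → (Vec.lookup (proj₂ x) i ≡ Vec.lookup (proj₂ x) j) ⇔ T (E i j))
parts-realise zero    E E-equiv = (0 , []) , here refl , λ ()
parts-realise (suc n) E E-equiv
  with parts-realise n (λ i j → E (fsuc i) (fsuc j)) (On.isEquivalence fsuc E-equiv)
     | any? (λ i → T? (E fzero (fsuc i)))
... | (p , ℓ) , y∈ , same | yes (i₀ , e₀) =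
  (p , Vec.lookup ℓ i₀ ∷ ℓ) , ∈-concatMap⁺ _ (lose y∈ (there (∈-map⁺ _ (∈-allFin (Vec.lookup ℓ i₀))))) , λ i j → mk⇔ (to i j) (from i j)
  where
  module E = IsEquivalence E-equiv
  to : ∀ i j → Vec.lookup (Vec.lookup ℓ i₀ ∷ ℓ) i ≡ Vec.lookup (Vec.lookup ℓ i₀ ∷ ℓ) j → T (E i j)
  to fzero    fzero    _ = E.refl
  to fzero    (fsuc j) e = E.trans e₀ (Equivalence.to (same i₀ j) e)
  to (fsuc i) fzero    e = E.sym (E.trans e₀ (Equivalence.to (same i₀ i) (sym e)))
  to (fsuc i) (fsuc j) e = Equivalence.to (same i j) e
  from : ∀ i j → T (E i j) → Vec.lookup (Vec.lookup ℓ i₀ ∷ ℓ) i ≡ Vec.lookup (Vec.lookup ℓ i₀ ∷ ℓ) j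
  from fzero    fzero    _ = refl
  from fzero    (fsuc j) t = Equivalence.from (same i₀ j) (E.trans (E.sym e₀) t)
  from (fsuc i) fzero    t = sym (Equivalence.from (same i₀ i) (E.trans (E.sym e₀) (E.sym t)))
  from (fsuc i) (fsuc j) t = Equivalence.from (same i j) t
... | (p , ℓ) , y∈ , same | no ¬joins =
  (suc p , fromℕ p ∷ Vec.map inject₁ ℓ) , ∈-concatMap⁺ _ (lose y∈ (here refl)) , λ i j → mk⇔ (to i j) (from i j)
  where
  module E = IsEquivalence E-equiv
  ℓ′ : Vec.Vec (Fin (suc p)) (suc n)
  ℓ′ = fromℕ p ∷ Vec.map inject₁ ℓ
  to : ∀ i j → Vec.lookup ℓ′ i ≡ Vec.lookup ℓ′ j → T (E i j)
  to fzero    fzero    _ = E.refl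
  to fzero    (fsuc j) e = ⊥-elim (fromℕ≢inject₁ (trans e (lookup-map j inject₁ ℓ)))
  to (fsuc i) fzero    e = ⊥-elim (fromℕ≢inject₁ (trans (sym e) (lookup-map i inject₁ ℓ)))
  to (fsuc i) (fsuc j) e = Equivalence.to (same i j)
    (inject₁-injective (trans (sym (lookup-map i inject₁ ℓ)) (trans e (lookup-map j inject₁ ℓ))))
  from : ∀ i j → T (E i j) → Vec.lookup ℓ′ i ≡ Vec.lookup ℓ′ j
  from fzero    fzero    _ = refl
  from fzero    (fsuc j) t = ⊥-elim (¬joins (j , t))
  from (fsuc i) fzero    t = ⊥-elim (¬joins (i , E.sym t))
  from (fsuc i) (fsuc j) t =
    trans (lookup-map i inject₁ ℓ) (trans (cong inject₁ (Equivalence.from (same i j) t)) (sym (lookup-map j inject₁ ℓ)))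

realise : (E : Fin n → Fin n → Bool) → IsEquivalence (T ∘₂ E) →
  Σ (Γ n) λ 𝒜 → ∀ i j → SameBlock 𝒜 i j ⇔ T (E i j)
realise {n} E E-equiv with parts-realise n E E-equiv
... | x , x∈ , same = ⟨ index x∈ ⟩ ,
  subst (λ y → ∀ i j → (Vec.lookup (proj₂ y) i ≡ Vec.lookup (proj₂ y) j) ⇔ T (E i j)) (lookup-index x∈) same

Meet : Γ n → Γ n → Fin n → Fin n → Set
Meet 𝒜 ℬ = EqClosure (λ i j → SameBlock 𝒜 i j ⊎ SameBlock ℬ i j)

-- meetSize 𝒜 ℬ is ω (meetGraph 𝒜 ℬ) by definition.
meetGraph : Γ n → Γ n → Graph n
meetGraph {n} 𝒜 ℬ = concatMap (λ i → concatMap (λ j →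
  if (label 𝒜 i == label 𝒜 j) ∨ (label ℬ i == label ℬ j) then (i , j) ∷ [] else []) (allFin n)) (allFin n)

∈-if : ∀ {A : Set} {x y : A} b → y ∈ (if b then x ∷ [] else []) ⇔ (T b × y ≡ x)
∈-if true  = mk⇔ (λ { (here y≡x) → _ , y≡x }) (λ (_ , y≡x) → here y≡x)
∈-if false = mk⇔ (λ ()) (λ ())

meetGraph-edge : ∀ (𝒜 ℬ : Γ n) i j → Edge (meetGraph 𝒜 ℬ) i j ⇔ (SameBlock 𝒜 i j ⊎ SameBlock ℬ i j)
meetGraph-edge {n} 𝒜 ℬ i j = mk⇔ to from
  where
  test : Fin n → Fin n → Bool
  test i j = (label 𝒜 i == label 𝒜 j) ∨ (label ℬ i == label ℬ j)
  blocks⇔ : ∀ i j → T (test i j) ⇔ (SameBlock 𝒜 i j ⊎ SameBlock ℬ i j)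
  blocks⇔ i j = mk⇔
    (Data.Sum.map (Equivalence.to ≡ᵇ-⇔) (Equivalence.to ≡ᵇ-⇔) ∘ Equivalence.to T-∨)
    (Equivalence.from (T-∨ {label 𝒜 i == label 𝒜 j}) ∘ Data.Sum.map (Equivalence.from ≡ᵇ-⇔) (Equivalence.from ≡ᵇ-⇔))
  to : Edge (meetGraph 𝒜 ℬ) i j → SameBlock 𝒜 i j ⊎ SameBlock ℬ i j
  to e∈ with find (∈-concatMap⁻ _ {xs = allFin n} e∈)
  ... | i′ , _ , e∈′ with find (∈-concatMap⁻ _ {xs = allFin n} e∈′)
  ... | j′ , _ , e∈″ with Equivalence.to (∈-if (test i′ j′)) e∈″
  ... | t , refl = Equivalence.to (blocks⇔ i j) t
  from : SameBlock 𝒜 i j ⊎ SameBlock ℬ i j → Edge (meetGraph 𝒜 ℬ) i j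
  from s = ∈-concatMap⁺ _ (lose (∈-allFin i) (∈-concatMap⁺ _ (lose (∈-allFin j)
    (Equivalence.from (∈-if (test i j)) (Equivalence.from (blocks⇔ i j) s , refl)))))

Meet⇔Connected : ∀ (𝒜 ℬ : Γ n) i j → Meet 𝒜 ℬ i j ⇔ Connected (meetGraph 𝒜 ℬ) i j
Meet⇔Connected 𝒜 ℬ i j = mk⇔ (EqClosure.map (Equivalence.from (meetGraph-edge 𝒜 ℬ _ _)))
                             (EqClosure.map (Equivalence.to (meetGraph-edge 𝒜 ℬ _ _)))

meetSize-classes : (𝒜 ℬ : Γ n) (E : Fin n → Fin n → Bool) →
  (∀ i j → Meet 𝒜 ℬ i j ⇔ T (E i j)) → meetSize 𝒜 ℬ ≡ classes E
meetSize-classes 𝒜 ℬ E Meet⇔E = trans (ω≡classes (meetGraph 𝒜 ℬ)) (classes-cong _ E λ i j →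
  Meet⇔E i j ⇔-∘ (⇔-sym (Meet⇔Connected 𝒜 ℬ i j) ⇔-∘ connected⇔Connected (meetGraph 𝒜 ℬ) i j))

Meet-comm : ∀ (𝒜 ℬ : Γ n) i j → Meet 𝒜 ℬ i j ⇔ Meet ℬ 𝒜 i j
Meet-comm 𝒜 ℬ i j = mk⇔ (EqClosure.map Data.Sum.swap) (EqClosure.map Data.Sum.swap)

meetSize-comm : (𝒜 ℬ : Γ n) → meetSize 𝒜 ℬ ≡ meetSize ℬ 𝒜
meetSize-comm 𝒜 ℬ = trans (meetSize-classes 𝒜 ℬ (connected (meetGraph ℬ 𝒜)) λ i j →
    ⇔-sym (connected⇔Connected (meetGraph ℬ 𝒜) i j) ⇔-∘ (Meet⇔Connected ℬ 𝒜 i j ⇔-∘ Meet-comm 𝒜 ℬ i j))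
  (sym (ω≡classes (meetGraph ℬ 𝒜)))

-- Identifying boundary points

contract-edge : (es : Graph m) (φ : Fin m → Fin m') → ∀ {w w′} → Edge (contract es φ) w w′ →
  ∃₂ λ a b → φ a ≡ w × φ b ≡ w′ × Edge es a b
contract-edge es φ e∈ with ∈-map⁻ _ e∈
... | (a , b) , ab∈ , refl = a , b , refl , refl , ab∈

contract-Connected : (es : Graph m) (φ : Fin m → Fin m') → ∀ {a b} →
  Connected es a b → Connected (contract es φ) (φ a) (φ b)
contract-Connected es φ = EqClosure.gmap φ (∈-map⁺ _)

-- Points P of some pieces, connected among themselves by Same, get identified along the
-- boundary Fin n; Link is the resulting relation on the boundary and Touch x i says that x is
-- connected to a point over boundary vertex i.
module Identification
  {P : Set} (Same : P → P → Set) (Same-equiv : IsEquivalence Same)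
  (Link : Fin n → Fin n → Set) (Link-equiv : IsEquivalence Link)
  (Touch : P → Fin n → Set)
  (Touch-resp : ∀ {x y i} → Same x y → Touch y i → Touch x i)
  (touches-link : ∀ {x i j} → Touch x i → Touch x j → Link i j)
  where

  private
    module S = IsEquivalence Same-equiv
    module L = IsEquivalence Link-equiv

  Through : P → P → Set
  Through x y = Same x y ⊎ ∃₂ λ i j → Touch x i × Link i j × Touch y j

  Through-isEquivalence : IsEquivalence Through
  Through-isEquivalence = record { refl = inj₁ S.refl ; sym = sym′ ; trans = trans′ }
    where
    sym′ : ∀ {x y} → Through x y → Through y x
    sym′ (inj₁ s)                 = inj₁ (S.sym s)
    sym′ (inj₂ (i , j , t , l , t′)) = inj₂ (j , i , t′ , L.sym l , t)
    trans′ : ∀ {x y z} → Through x y → Through y z → Through x z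
    trans′ (inj₁ s) (inj₁ s′) = inj₁ (S.trans s s′)
    trans′ (inj₁ s) (inj₂ (i , j , t , l , t′)) = inj₂ (i , j , Touch-resp s t , l , t′)
    trans′ (inj₂ (i , j , t , l , t′)) (inj₁ s) = inj₂ (i , j , t , l , Touch-resp (S.sym s) t′)
    trans′ (inj₂ (i , j , t , l , t′)) (inj₂ (i′ , j′ , u , l′ , u′)) =
      inj₂ (i , j′ , t , L.trans l (L.trans (touches-link t′ u) l′) , u′)

  Through-ports : (p : Fin n → P) → (∀ i → Touch (p i) i) → ∀ {i j} → Through (p i) (p j) → Link i j
  Through-ports p touches {i} {j} (inj₁ s) = touches-link (touches i) (Touch-resp s (touches j))
  Through-ports p touches {i} {j} (inj₂ (i′ , j′ , t , l , t′)) =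
    L.trans (touches-link (touches i) t) (L.trans l (touches-link t′ (touches j)))

  module _ (φ : P → Fin m) (ψ : Fin m → P) (φ∘ψ : ∀ w → φ (ψ w) ≡ w)
    (port : Fin n → Fin m) (port-link : ∀ {i j} → port i ≡ port j → Link i j)
    -- every point lies over a boundary vertex, or is the only point over its image
    (kind : ∀ x → (∃ λ i → φ x ≡ port i × Touch x i) ⊎ (ψ (φ x) ≡ x × ∀ i → φ x ≢ port i))
    where

    Through-base : ∀ x y → φ x ≡ φ y → Through x y
    Through-base x y φx≡φy with kind x | kind y
    ... | inj₁ (i , φx≡ , t) | inj₁ (j , φy≡ , t′) =
      inj₂ (i , j , t , port-link (trans (sym φx≡) (trans φx≡φy φy≡)) , t′)
    ... | inj₁ (i , φx≡ , _) | inj₂ (_ , off) = ⊥-elim (off i (trans (sym φx≡φy) φx≡))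
    ... | inj₂ (_ , off) | inj₁ (j , φy≡ , _) = ⊥-elim (off j (trans φx≡φy φy≡))
    ... | inj₂ (x≡ , _) | inj₂ (y≡ , _) = inj₁ (subst (Same x) (trans (sym x≡) (trans (cong ψ φx≡φy) y≡)) S.refl)

    -- Through is an equivalence containing all edges and all identifications.
    Through-lift : (G : Graph m) → (∀ {w w′} → Edge G w w′ → ∃₂ λ a b → φ a ≡ w × φ b ≡ w′ × Same a b) →
      ∀ {x y} → Connected G (φ x) (φ y) → Through x y
    Through-lift G edge {x} {y} c =
      T.trans (Through-base x _ (sym (φ∘ψ (φ x))))
        (T.trans (EqClosure.fold (On.isEquivalence ψ Through-isEquivalence) step c)
                 (Through-base _ y (φ∘ψ (φ y))))
      where
      module T = IsEquivalence Through-isEquivalence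
      step : ∀ {w w′} → Edge G w w′ → Through (ψ w) (ψ w′)
      step e with edge e
      ... | a , b , refl , refl , s =
        T.trans (Through-base _ a (φ∘ψ (φ a))) (T.trans (inj₁ s) (Through-base b _ (sym (φ∘ψ (φ b)))))

-- Quotients of a graph with boundary

module Boundary (n k : ℕ) (X : Graph (n + k)) where

  partition : Γ n
  partition = proj₁ (realise (λ i j → connected X (i ↑ˡ k) (j ↑ˡ k))
                             (On.isEquivalence (_↑ˡ k) (connected-isEquivalence X)))

  partition-⇔ : ∀ i j → SameBlock partition i j ⇔ Connected X (i ↑ˡ k) (j ↑ˡ k)
  partition-⇔ i j = connected⇔Connected X _ _
    ⇔-∘ proj₂ (realise (λ i j → connected X (i ↑ˡ k) (j ↑ˡ k))
                       (On.isEquivalence (_↑ˡ k) (connected-isEquivalence X))) i j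

  -- Each component avoiding the boundary is counted by its least vertex.
  detached : ℕ
  detached = count (λ j → isLeader (connected X) (n ↑ʳ j))

  module Quotient (𝒜 : Γ n) where

    q : Fin (n + k) → Fin (blocks 𝒜 + k)
    q = quotientMap n k 𝒜

    q-↑ˡ : ∀ i → q (i ↑ˡ k) ≡ label 𝒜 i ↑ˡ k
    q-↑ˡ i rewrite splitAt-↑ˡ n i k = refl

    q-↑ʳ : ∀ j → q (n ↑ʳ j) ≡ blocks 𝒜 ↑ʳ j
    q-↑ʳ j rewrite splitAt-↑ʳ n k j = refl

    ψ : Fin (blocks 𝒜 + k) → Fin (n + k)
    ψ w with splitAt (blocks 𝒜) w
    ... | inj₁ b = proj₁ (label-onto 𝒜 b) ↑ˡ k
    ... | inj₂ j = n ↑ʳ j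

    q∘ψ : ∀ w → q (ψ w) ≡ w
    q∘ψ w with splitAt (blocks 𝒜) w in eq
    ... | inj₁ b = trans (q-↑ˡ _) (trans (cong (_↑ˡ k) (proj₂ (label-onto 𝒜 b))) (splitAt⁻¹-↑ˡ eq))
    ... | inj₂ j = trans (q-↑ʳ j) (splitAt⁻¹-↑ʳ eq)

    ψ-↑ʳ : ∀ j → ψ (blocks 𝒜 ↑ʳ j) ≡ n ↑ʳ j
    ψ-↑ʳ j rewrite splitAt-↑ʳ (blocks 𝒜) k j = refl

    Touch : Fin (n + k) → Fin n → Set
    Touch a i = Connected X a (i ↑ˡ k)

    touches-link : ∀ {a i j} → Touch a i → Touch a j → Meet partition 𝒜 i j
    touches-link t t′ = EqClosure.return (inj₁ (Equivalence.from (partition-⇔ _ _)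
      (EqClosure.transitive _ (EqClosure.symmetric _ t) t′)))

    open Identification (Connected X) (EqClosure.isEquivalence _) (Meet partition 𝒜)
      (EqClosure.isEquivalence _) Touch (EqClosure.transitive _) touches-link

    kind : ∀ a → (∃ λ i → q a ≡ q (i ↑ˡ k) × Touch a i) ⊎ (ψ (q a) ≡ a × ∀ i → q a ≢ q (i ↑ˡ k))
    kind a with splitAt-view n k a
    ... | left i  = inj₁ (i , refl , ε)
    ... | right j = inj₂ (trans (cong ψ (q-↑ʳ j)) (ψ-↑ʳ j) ,
                          λ i eq → ↑ˡ≢↑ʳ _ j (trans (sym (q-↑ˡ i)) (trans (sym eq) (q-↑ʳ j))))

    port-link : ∀ {i j} → q (i ↑ˡ k) ≡ q (j ↑ˡ k) → Meet partition 𝒜 i j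
    port-link {i} {j} eq = EqClosure.return (inj₂ (↑ˡ-injective k _ _ (trans (sym (q-↑ˡ i)) (trans eq (q-↑ˡ j)))))

    lift : ∀ {a b} → Connected (X / 𝒜) (q a) (q b) → Through a b
    lift = Through-lift q ψ q∘ψ (λ i → q (i ↑ˡ k)) port-link kind (X / 𝒜)
      (λ e → let (a , b , qa , qb , ab) = contract-edge X q e in a , b , qa , qb , EqClosure.return ab)

    Rq : Fin (n + k) → Fin (n + k) → Bool
    Rq u v = connected (X / 𝒜) (q u) (q v)

    boundary⇔ : ∀ i j → Meet partition 𝒜 i j ⇔ T (Rq (i ↑ˡ k) (j ↑ˡ k))
    boundary⇔ i j = mk⇔
      (Connected⇒connected ∘ down)
      (Through-ports (_↑ˡ k) (λ _ → ε) ∘ lift ∘ connected⇒Connected)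
      where
      link : ∀ {i j} → SameBlock partition i j ⊎ SameBlock 𝒜 i j → Connected (X / 𝒜) (q (i ↑ˡ k)) (q (j ↑ˡ k))
      link (inj₁ same) = contract-Connected X q (Equivalence.to (partition-⇔ _ _) same)
      link {i} {j} (inj₂ same) = subst (Connected (X / 𝒜) (q (i ↑ˡ k)))
        (trans (q-↑ˡ i) (trans (cong (_↑ˡ k) same) (sym (q-↑ˡ j)))) ε
      down : Meet partition 𝒜 i j → Connected (X / 𝒜) (q (i ↑ˡ k)) (q (j ↑ˡ k))
      down = EqClosure.fold (On.isEquivalence (q ∘ (_↑ˡ k)) (EqClosure.isEquivalence _)) link

    detached-leader : ∀ j → isLeader Rq (n ↑ʳ j) ≡ isLeader (connected X) (n ↑ʳ j)
    detached-leader j = isLeader-cong Rq (connected X) (n ↑ʳ j) (n ↑ʳ j) to from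
      where
      to : Dominated Rq (n ↑ʳ j) → Dominated (connected X) (n ↑ʳ j)
      to (u , u< , r) with lift (connected⇒Connected r)
      ... | inj₁ c = u , u< , Connected⇒connected c
      ... | inj₂ (_ , i , _ , _ , t) =
        i ↑ˡ k , ↑ˡ<↑ʳ i j , Connected⇒connected (EqClosure.symmetric _ t)
      from : Dominated (connected X) (n ↑ʳ j) → Dominated Rq (n ↑ʳ j)
      from (u , u< , r) = u , u< , Connected⇒connected
        (contract-Connected X q (connected⇒Connected r))

    ω-quotient : ω (X / 𝒜) ≡ meetSize partition 𝒜 + detached
    ω-quotient = begin
      ω (X / 𝒜)                                ≡⟨ ω≡classes (X / 𝒜) ⟩
      classes (connected (X / 𝒜))              ≡⟨ classes-pullback _ (connected-isEquivalence (X / 𝒜)) q onto ⟨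
      classes Rq                               ≡⟨ classes-↑ n k Rq ⟩
      classes (λ i j → Rq (i ↑ˡ k) (j ↑ˡ k)) + count (λ j → isLeader Rq (n ↑ʳ j))
        ≡⟨ cong₂ _+_ (meetSize-classes partition 𝒜 _ boundary⇔) (sym (count-cong detached-leader)) ⟨
      meetSize partition 𝒜 + detached          ∎
      where
      open ≡-Reasoning
      onto : ∀ w → ∃ λ u → T (connected (X / 𝒜) w (q u))
      onto w = ψ w , subst (T ∘ connected (X / 𝒜) w) (sym (q∘ψ w))
                           (IsEquivalence.refl (connected-isEquivalence (X / 𝒜)))

-- Gluing along the boundary

module Gluing (n k h : ℕ) (A : Graph (n + k)) (C : Graph (n + h)) where

  private
    module A = Boundary n k A
    module C = Boundary n h C

  G : Graph (n + (k + h))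
  G = glue n k h A C

  eK : Fin (n + k) → Fin (n + (k + h))
  eK = embK n k h

  eH : Fin (n + h) → Fin (n + (k + h))
  eH = embH n k h

  eK-↑ˡ : ∀ i → eK (i ↑ˡ k) ≡ i ↑ˡ (k + h)
  eK-↑ˡ i rewrite splitAt-↑ˡ n i k = refl

  eK-↑ʳ : ∀ j → eK (n ↑ʳ j) ≡ n ↑ʳ (j ↑ˡ h)
  eK-↑ʳ j rewrite splitAt-↑ʳ n k j = refl

  eH-↑ˡ : ∀ i → eH (i ↑ˡ h) ≡ i ↑ˡ (k + h)
  eH-↑ˡ i rewrite splitAt-↑ˡ n i h = refl

  eH-↑ʳ : ∀ j → eH (n ↑ʳ j) ≡ n ↑ʳ (k ↑ʳ j)
  eH-↑ʳ j rewrite splitAt-↑ʳ n h j = refl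

  P : Set
  P = Fin (n + k) ⊎ Fin (n + h)

  φ : P → Fin (n + (k + h))
  φ = Data.Sum.[ eK , eH ]

  ψ : Fin (n + (k + h)) → P
  ψ w with splitAt n w
  ... | inj₁ i = inj₁ (i ↑ˡ k)
  ... | inj₂ j with splitAt k j
  ...   | inj₁ a = inj₁ (n ↑ʳ a)
  ...   | inj₂ c = inj₂ (n ↑ʳ c)

  φ∘ψ : ∀ w → φ (ψ w) ≡ w
  φ∘ψ w with splitAt n w in eq
  ... | inj₁ i = trans (eK-↑ˡ i) (splitAt⁻¹-↑ˡ eq)
  ... | inj₂ j with splitAt k j in eq′
  ...   | inj₁ a = trans (eK-↑ʳ a) (trans (cong (n ↑ʳ_) (splitAt⁻¹-↑ˡ eq′)) (splitAt⁻¹-↑ʳ eq))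
  ...   | inj₂ c = trans (eH-↑ʳ c) (trans (cong (n ↑ʳ_) (splitAt⁻¹-↑ʳ eq′)) (splitAt⁻¹-↑ʳ eq))

  ψ-eK-↑ʳ : ∀ j → ψ (n ↑ʳ (j ↑ˡ h)) ≡ inj₁ (n ↑ʳ j)
  ψ-eK-↑ʳ j rewrite splitAt-↑ʳ n (k + h) (j ↑ˡ h) | splitAt-↑ˡ k j h = refl

  ψ-eH-↑ʳ : ∀ j → ψ (n ↑ʳ (k ↑ʳ j)) ≡ inj₂ (n ↑ʳ j)
  ψ-eH-↑ʳ j rewrite splitAt-↑ʳ n (k + h) (k ↑ʳ j) | splitAt-↑ʳ k h j = refl

  Same : P → P → Set
  Same (inj₁ a) (inj₁ b) = Connected A a b
  Same (inj₂ c) (inj₂ d) = Connected C c d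
  Same _        _        = ⊥

  Same-isEquivalence : IsEquivalence Same
  Same-isEquivalence = record { refl = refl′ ; sym = sym′ ; trans = trans′ }
    where
    refl′ : ∀ {x} → Same x x
    refl′ {inj₁ _} = ε
    refl′ {inj₂ _} = ε
    sym′ : ∀ {x y} → Same x y → Same y x
    sym′ {inj₁ _} {inj₁ _} = EqClosure.symmetric _
    sym′ {inj₂ _} {inj₂ _} = EqClosure.symmetric _
    trans′ : ∀ {x y z} → Same x y → Same y z → Same x z
    trans′ {inj₁ _} {inj₁ _} {inj₁ _} = EqClosure.transitive _
    trans′ {inj₂ _} {inj₂ _} {inj₂ _} = EqClosure.transitive _

  Touch : P → Fin n → Set
  Touch (inj₁ a) i = Connected A a (i ↑ˡ k)
  Touch (inj₂ c) i = Connected C c (i ↑ˡ h)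

  Touch-resp : ∀ {x y i} → Same x y → Touch y i → Touch x i
  Touch-resp {inj₁ _} {inj₁ _} = EqClosure.transitive _
  Touch-resp {inj₂ _} {inj₂ _} = EqClosure.transitive _

  touches-link : ∀ {x i j} → Touch x i → Touch x j → Meet A.partition C.partition i j
  touches-link {inj₁ _} t t′ = EqClosure.return (inj₁ (Equivalence.from (A.partition-⇔ _ _)
    (EqClosure.transitive _ (EqClosure.symmetric _ t) t′)))
  touches-link {inj₂ _} t t′ = EqClosure.return (inj₂ (Equivalence.from (C.partition-⇔ _ _)
    (EqClosure.transitive _ (EqClosure.symmetric _ t) t′)))

  open Identification Same Same-isEquivalence (Meet A.partition C.partition) (EqClosure.isEquivalence _)
    Touch Touch-resp touches-link

  kind : ∀ x → (∃ λ (i : Fin n) → φ x ≡ i ↑ˡ (k + h) × Touch x i) ⊎ (ψ (φ x) ≡ x × ∀ (i : Fin n) → φ x ≢ i ↑ˡ (k + h))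
  kind (inj₁ a) with splitAt-view n k a
  ... | left i  = inj₁ (i , eK-↑ˡ i , ε)
  ... | right j = inj₂ (trans (cong ψ (eK-↑ʳ j)) (ψ-eK-↑ʳ j) , λ i eq → ↑ˡ≢↑ʳ {n} {k + h} i (j ↑ˡ h) (trans (sym eq) (eK-↑ʳ j)))
  kind (inj₂ c) with splitAt-view n h c
  ... | left i  = inj₁ (i , eH-↑ˡ i , ε)
  ... | right j = inj₂ (trans (cong ψ (eH-↑ʳ j)) (ψ-eH-↑ʳ j) , λ i eq → ↑ˡ≢↑ʳ {n} {k + h} i (k ↑ʳ j) (trans (sym eq) (eH-↑ʳ j)))

  port-link : ∀ {i j} → i ↑ˡ (k + h) ≡ j ↑ˡ (k + h) → Meet A.partition C.partition i j
  port-link eq rewrite ↑ˡ-injective (k + h) _ _ eq = ε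

  edge : ∀ {w w′} → Edge G w w′ → ∃₂ λ a b → φ a ≡ w × φ b ≡ w′ × Same a b
  edge e with ∈-++⁻ (contract A eK) e
  ... | inj₁ e∈ = let (a , b , ea , eb , ab) = contract-edge A eK e∈ in inj₁ a , inj₁ b , ea , eb , EqClosure.return ab
  ... | inj₂ e∈ = let (c , d , ec , ed , cd) = contract-edge C eH e∈ in inj₂ c , inj₂ d , ec , ed , EqClosure.return cd

  lift : ∀ {x y} → Connected G (φ x) (φ y) → Through x y
  lift = Through-lift φ ψ φ∘ψ (_↑ˡ (k + h)) port-link kind G edge

  liftK : ∀ {a b} → Connected A a b → Connected G (eK a) (eK b)
  liftK = EqClosure.map ∈-++⁺ˡ ∘ contract-Connected A eK

  liftH : ∀ {c d} → Connected C c d → Connected G (eH c) (eH d)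
  liftH = EqClosure.map (∈-++⁺ʳ (contract A eK)) ∘ contract-Connected C eH

  boundary⇔ : ∀ i j → Meet A.partition C.partition i j ⇔ T (connected G (i ↑ˡ (k + h)) (j ↑ˡ (k + h)))
  boundary⇔ i j = mk⇔ (Connected⇒connected ∘ down) up
    where
    link : ∀ {i j} → SameBlock A.partition i j ⊎ SameBlock C.partition i j →
      Connected G (i ↑ˡ (k + h)) (j ↑ˡ (k + h))
    link {i} {j} (inj₁ same) = subst₂ (Connected G) (eK-↑ˡ i) (eK-↑ˡ j) (liftK (Equivalence.to (A.partition-⇔ i j) same))
    link {i} {j} (inj₂ same) = subst₂ (Connected G) (eH-↑ˡ i) (eH-↑ˡ j) (liftH (Equivalence.to (C.partition-⇔ i j) same))
    down : Meet A.partition C.partition i j → Connected G (i ↑ˡ (k + h)) (j ↑ˡ (k + h))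
    down = EqClosure.fold (On.isEquivalence (_↑ˡ (k + h)) (EqClosure.isEquivalence _)) link
    up : T (connected G (i ↑ˡ (k + h)) (j ↑ˡ (k + h))) → Meet A.partition C.partition i j
    up r = Through-ports (λ i → inj₁ (i ↑ˡ k)) (λ _ → ε)
      (lift {inj₁ (i ↑ˡ k)} {inj₁ (j ↑ˡ k)} (subst₂ (Connected G) (sym (eK-↑ˡ i)) (sym (eK-↑ˡ j)) (connected⇒Connected r)))

  -- A component of a piece X avoiding the boundary stays a component of G, and φ ∘ σ
  -- preserves the order of vertices, so it keeps its least vertex.
  detached-leader : ∀ {r} (X : Graph (n + r)) (σ : Fin (n + r) → P) →
    (∀ {x a} → Same x (σ a) → ∃ λ b → x ≡ σ b × Connected X b a) →
    (∀ {a i} → Touch (σ a) i → Connected X a (i ↑ˡ r)) →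
    (∀ {a b} → Connected X a b → Connected G (φ (σ a)) (φ (σ b))) →
    (∀ a b → toℕ a < toℕ b ⇔ toℕ (φ (σ a)) < toℕ (φ (σ b))) →
    ∀ j → isLeader (connected G) (φ (σ (n ↑ʳ j))) ≡ isLeader (connected X) (n ↑ʳ j)
  detached-leader {r} X σ σ-Same σ-Touch σ-Connected σ-< j =
    isLeader-cong (connected G) (connected X) (φ (σ v)) v to from
    where
    v : Fin (n + r)
    v = n ↑ʳ j
    to : Dominated (connected G) (φ (σ v)) → Dominated (connected X) v
    to (u , u< , c) with lift {ψ u} {σ v} (subst (λ w → Connected G w (φ (σ v))) (sym (φ∘ψ u))
                                   (connected⇒Connected c))
    ... | inj₁ same with σ-Same same
    ...   | b , ψu≡σb , c′ = b , Equivalence.from (σ-< b v) (subst (λ w → toℕ w < toℕ (φ (σ v))) (trans (sym (φ∘ψ u)) (cong φ ψu≡σb)) u<) ,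
                            Connected⇒connected c′
    to _ | inj₂ (_ , i , _ , _ , t) = i ↑ˡ r , ↑ˡ<↑ʳ i j ,
      Connected⇒connected (EqClosure.symmetric _ (σ-Touch t))
    from : Dominated (connected X) v → Dominated (connected G) (φ (σ v))
    from (a , a< , c) = φ (σ a) , Equivalence.to (σ-< a v) a< ,
      Connected⇒connected (σ-Connected (connected⇒Connected c))

  toℕ-eK : ∀ a → toℕ (eK a) ≡ toℕ a
  toℕ-eK a with splitAt-view n k a
  ... | left i  = trans (cong toℕ (eK-↑ˡ i)) (trans (toℕ-↑ˡ i (k + h)) (sym (toℕ-↑ˡ i k)))
  ... | right j = trans (cong toℕ (eK-↑ʳ j))
                   (trans (toℕ-↑ʳ n (j ↑ˡ h)) (trans (cong (n +_) (toℕ-↑ˡ j h)) (sym (toℕ-↑ʳ n j))))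

  eK-< : ∀ a b → toℕ a < toℕ b ⇔ toℕ (eK a) < toℕ (eK b)
  eK-< a b = mk⇔ (subst₂ _<_ (sym (toℕ-eK a)) (sym (toℕ-eK b))) (subst₂ _<_ (toℕ-eK a) (toℕ-eK b))

  toℕ-eH-↑ˡ : ∀ i → toℕ (eH (i ↑ˡ h)) ≡ toℕ (i ↑ˡ h)
  toℕ-eH-↑ˡ i = trans (cong toℕ (eH-↑ˡ i)) (trans (toℕ-↑ˡ i (k + h)) (sym (toℕ-↑ˡ i h)))

  toℕ-eH-↑ʳ : ∀ j → toℕ (eH (n ↑ʳ j)) ≡ n + (k + toℕ j)
  toℕ-eH-↑ʳ j = trans (cong toℕ (eH-↑ʳ j)) (trans (toℕ-↑ʳ n (k ↑ʳ j)) (cong (n +_) (toℕ-↑ʳ k j)))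

  eH-↑ˡ<eH-↑ʳ : ∀ i j → toℕ (eH (i ↑ˡ h)) < toℕ (eH (n ↑ʳ j))
  eH-↑ˡ<eH-↑ʳ i j = subst₂ _<_ (cong toℕ (sym (eH-↑ˡ i))) (cong toℕ (sym (eH-↑ʳ j))) (↑ˡ<↑ʳ i (k ↑ʳ j))

  eH-< : ∀ c d → toℕ c < toℕ d ⇔ toℕ (eH c) < toℕ (eH d)
  eH-< c d with splitAt-view n h c | splitAt-view n h d
  ... | left i  | left i′  = mk⇔ (subst₂ _<_ (sym (toℕ-eH-↑ˡ i)) (sym (toℕ-eH-↑ˡ i′)))
                                 (subst₂ _<_ (toℕ-eH-↑ˡ i) (toℕ-eH-↑ˡ i′))
  ... | left i  | right j  = mk⇔ (λ _ → eH-↑ˡ<eH-↑ʳ i j) (λ _ → ↑ˡ<↑ʳ i j)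
  ... | right j | left i   = mk⇔ (⊥-elim ∘ <-asym (↑ˡ<↑ʳ i j)) (⊥-elim ∘ <-asym (eH-↑ˡ<eH-↑ʳ i j))
  ... | right j | right j′ = mk⇔
    (subst₂ _<_ (sym (toℕ-eH-↑ʳ j)) (sym (toℕ-eH-↑ʳ j′)) ∘ +-monoʳ-< n ∘ +-monoʳ-< k ∘ +-cancelˡ-< n _ _ ∘
     subst₂ _<_ (toℕ-↑ʳ n j) (toℕ-↑ʳ n j′))
    (subst₂ _<_ (sym (toℕ-↑ʳ n j)) (sym (toℕ-↑ʳ n j′)) ∘ +-monoʳ-< n ∘ +-cancelˡ-< k _ _ ∘ +-cancelˡ-< n _ _ ∘
     subst₂ _<_ (toℕ-eH-↑ʳ j) (toℕ-eH-↑ʳ j′))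

  ω-glue : ω G ≡ meetSize A.partition C.partition + (A.detached + C.detached)
  ω-glue = begin
    ω G                                  ≡⟨ ω≡classes G ⟩
    classes (connected G)                ≡⟨ classes-↑ n (k + h) (connected G) ⟩
    classes (λ (i j : Fin n) → connected G (i ↑ˡ (k + h)) (j ↑ˡ (k + h))) + count (λ w → isLeader (connected G) (n ↑ʳ w))
      ≡⟨ cong₂ _+_ (meetSize-classes A.partition C.partition _ boundary⇔) (sym (count-↑ k h _)) ⟨
    meetSize A.partition C.partition +
      (count (λ j → isLeader (connected G) (n ↑ʳ (j ↑ˡ h))) + count (λ j → isLeader (connected G) (n ↑ʳ (k ↑ʳ j))))
      ≡⟨ cong (meetSize A.partition C.partition +_) (cong₂ _+_ (count-cong detachedK) (count-cong detachedH)) ⟩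
    meetSize A.partition C.partition + (A.detached + C.detached) ∎
    where
    open ≡-Reasoning
    detachedK : ∀ j → isLeader (connected G) (n ↑ʳ (j ↑ˡ h)) ≡ isLeader (connected A) (n ↑ʳ j)
    detachedK j = trans (cong (isLeader (connected G)) (sym (eK-↑ʳ j)))
      (detached-leader A inj₁ (λ { {inj₁ b} s → b , refl , s }) (λ t → t) liftK eK-< j)
    detachedH : ∀ j → isLeader (connected G) (n ↑ʳ (k ↑ʳ j)) ≡ isLeader (connected C) (n ↑ʳ j)
    detachedH j = trans (cong (isLeader (connected G)) (sym (eH-↑ʳ j)))
      (detached-leader C inj₂ (λ { {inj₂ d} s → d , refl , s }) (λ t → t) liftH eH-< j)

-- State sums

module Expansion {c ℓ} (R : CommutativeRing c ℓ) where

  open CommutativeRing R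
    using (Carrier; _≈_; setoid; semiring; *-commutativeMonoid; *-commutativeSemigroup;
           +-cong; +-congˡ; *-cong; *-congˡ; *-congʳ; *-comm; *-assoc; *-identityˡ; *-identityʳ;
           +-identityˡ; +-identityʳ; +-assoc; distribˡ; zeroʳ)
    renaming (_+_ to _⊕_; _*_ to _⊛_)
  open Poly R using (pow; sumL; ΣΓ; negami; triple) renaming (T to Tₙ)
  open import Algebra.Properties.Semiring.Sum semiring using (sum; sum-cong-≋; ∑-distrib-+; *-distribˡ-sum; *-distribʳ-sum)
  open import Algebra.Properties.CommutativeSemigroup *-commutativeSemigroup using (x∙yz≈y∙xz)
  import Algebra.Solver.CommutativeMonoid *-commutativeMonoid as Solver
  open SetoidReasoning setoid
  private module ≈ = Setoid setoid

  pow-+ : ∀ a m k → pow a (m + k) ≈ pow a m ⊛ pow a k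
  pow-+ a zero    k = ≈.sym (*-identityˡ _)
  pow-+ a (suc m) k = ≈.trans (*-congˡ (pow-+ a m k)) (≈.sym (*-assoc _ _ _))

  sumL-++ : ∀ xs ys → sumL (xs ++ ys) ≈ sumL xs ⊕ sumL ys
  sumL-++ []       ys = ≈.sym (+-identityˡ _)
  sumL-++ (x ∷ xs) ys = ≈.trans (+-congˡ (sumL-++ xs ys)) (≈.sym (+-assoc _ _ _))

  sumL-map-*ˡ : ∀ {A : Set} a (f g : A → Carrier) → (∀ s → f s ≈ a ⊛ g s) →
    ∀ xs → sumL (map f xs) ≈ a ⊛ sumL (map g xs)
  sumL-map-*ˡ a f g f≈ag []       = ≈.sym (zeroʳ a)
  sumL-map-*ˡ a f g f≈ag (x ∷ xs) = ≈.trans (+-cong (f≈ag x) (sumL-map-*ˡ a f g f≈ag xs)) (≈.sym (distribˡ _ _ _))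

  sumL-tabulate : ∀ {N} (f : Fin N → Carrier) → sumL (tabulate f) ≡ sum f
  sumL-tabulate {zero}  f = refl
  sumL-tabulate {suc N} f = cong (f fzero ⊕_) (sumL-tabulate (f ∘ fsuc))

  ΣΓ≡sum : ∀ {n} (g : Γ n → Carrier) → ΣΓ g ≡ sum (λ i → g ⟨ i ⟩)
  ΣΓ≡sum {n} g = trans (cong sumL (map-tabulate (λ i → i) (λ i → g ⟨ i ⟩))) (sumL-tabulate (λ i → g ⟨ i ⟩))

  ΣΓ-cong : ∀ {n} {f g : Γ n → Carrier} → (∀ 𝒜 → f 𝒜 ≈ g 𝒜) → ΣΓ f ≈ ΣΓ g
  ΣΓ-cong {f = f} {g} f≈g = begin
    ΣΓ f                 ≡⟨ ΣΓ≡sum f ⟩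
    sum (λ i → f ⟨ i ⟩)  ≈⟨ sum-cong-≋ (λ i → f≈g ⟨ i ⟩) ⟩
    sum (λ i → g ⟨ i ⟩)  ≡⟨ ΣΓ≡sum g ⟨
    ΣΓ g                 ∎

  ΣΓ-distrib-⊕ : ∀ {n} (f g : Γ n → Carrier) → ΣΓ (λ 𝒜 → f 𝒜 ⊕ g 𝒜) ≈ ΣΓ f ⊕ ΣΓ g
  ΣΓ-distrib-⊕ f g = begin
    ΣΓ (λ 𝒜 → f 𝒜 ⊕ g 𝒜)                     ≡⟨ ΣΓ≡sum (λ 𝒜 → f 𝒜 ⊕ g 𝒜) ⟩
    sum (λ i → f ⟨ i ⟩ ⊕ g ⟨ i ⟩)             ≈⟨ ∑-distrib-+ (λ i → f ⟨ i ⟩) (λ i → g ⟨ i ⟩) ⟩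
    sum (λ i → f ⟨ i ⟩) ⊕ sum (λ i → g ⟨ i ⟩) ≡⟨ cong₂ _⊕_ (ΣΓ≡sum f) (ΣΓ≡sum g) ⟨
    ΣΓ f ⊕ ΣΓ g                              ∎

  *-distribˡ-ΣΓ : ∀ {n} a (f : Γ n → Carrier) → a ⊛ ΣΓ f ≈ ΣΓ (λ 𝒜 → a ⊛ f 𝒜)
  *-distribˡ-ΣΓ a f = begin
    a ⊛ ΣΓ f                  ≡⟨ cong (a ⊛_) (ΣΓ≡sum f) ⟩
    a ⊛ sum (λ i → f ⟨ i ⟩)   ≈⟨ *-distribˡ-sum a (λ i → f ⟨ i ⟩) ⟩
    sum (λ i → a ⊛ f ⟨ i ⟩)   ≡⟨ ΣΓ≡sum (λ 𝒜 → a ⊛ f 𝒜) ⟨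
    ΣΓ (λ 𝒜 → a ⊛ f 𝒜)        ∎

  *-distribʳ-ΣΓ : ∀ {n} a (f : Γ n → Carrier) → ΣΓ f ⊛ a ≈ ΣΓ (λ 𝒜 → f 𝒜 ⊛ a)
  *-distribʳ-ΣΓ a f = begin
    ΣΓ f ⊛ a                  ≡⟨ cong (_⊛ a) (ΣΓ≡sum f) ⟩
    sum (λ i → f ⟨ i ⟩) ⊛ a   ≈⟨ *-distribʳ-sum a (λ i → f ⟨ i ⟩) ⟩
    sum (λ i → f ⟨ i ⟩ ⊛ a)   ≡⟨ ΣΓ≡sum (λ 𝒜 → f 𝒜 ⊛ a) ⟨
    ΣΓ (λ 𝒜 → f 𝒜 ⊛ a)        ∎

  module StateSum (x y : Carrier) where

    stateSum : {E : Set} → List E → (List E → Carrier) → Carrier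
    stateSum []       F = F []
    stateSum (e ∷ es) F = x ⊛ stateSum es (F ∘ (e ∷_)) ⊕ y ⊛ stateSum es F

    stateSum-cong : ∀ {E : Set} (es : List E) {F G : List E → Carrier} →
      (∀ S → F S ≈ G S) → stateSum es F ≈ stateSum es G
    stateSum-cong []       F≈G = F≈G []
    stateSum-cong (e ∷ es) F≈G = +-cong (*-congˡ (stateSum-cong es (F≈G ∘ (e ∷_)))) (*-congˡ (stateSum-cong es F≈G))

    stateSum-++ : ∀ {E : Set} (es fs : List E) (F : List E → Carrier) →
      stateSum (es ++ fs) F ≡ stateSum es (λ S → stateSum fs (λ S′ → F (S ++ S′)))
    stateSum-++ []       fs F = refl
    stateSum-++ (e ∷ es) fs F = cong₂ (λ a b → x ⊛ a ⊕ y ⊛ b) (stateSum-++ es fs (F ∘ (e ∷_))) (stateSum-++ es fs F)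

    stateSum-map : ∀ {E E′ : Set} (f : E → E′) (es : List E) (F : List E′ → Carrier) →
      stateSum (map f es) F ≡ stateSum es (F ∘ map f)
    stateSum-map f []       F = refl
    stateSum-map f (e ∷ es) F = cong₂ (λ a b → x ⊛ a ⊕ y ⊛ b) (stateSum-map f es (F ∘ (f e ∷_))) (stateSum-map f es F)

    stateSum-*ˡ : ∀ {E : Set} (es : List E) a (F : List E → Carrier) →
      stateSum es (λ S → a ⊛ F S) ≈ a ⊛ stateSum es F
    stateSum-*ˡ []       a F = ≈.refl
    stateSum-*ˡ (e ∷ es) a F = begin
      x ⊛ stateSum es (λ S → a ⊛ F (e ∷ S)) ⊕ y ⊛ stateSum es (λ S → a ⊛ F S)
        ≈⟨ +-cong (*-congˡ (stateSum-*ˡ es a (F ∘ (e ∷_)))) (*-congˡ (stateSum-*ˡ es a F)) ⟩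
      x ⊛ (a ⊛ stateSum es (F ∘ (e ∷_))) ⊕ y ⊛ (a ⊛ stateSum es F)
        ≈⟨ +-cong (x∙yz≈y∙xz x a _) (x∙yz≈y∙xz y a _) ⟩
      a ⊛ (x ⊛ stateSum es (F ∘ (e ∷_))) ⊕ a ⊛ (y ⊛ stateSum es F)
        ≈⟨ distribˡ a _ _ ⟨
      a ⊛ stateSum (e ∷ es) F ∎

    stateSum-*ʳ : ∀ {E : Set} (es : List E) a (F : List E → Carrier) →
      stateSum es (λ S → F S ⊛ a) ≈ stateSum es F ⊛ a
    stateSum-*ʳ es a F =
      ≈.trans (stateSum-cong es (λ S → *-comm (F S) a)) (≈.trans (stateSum-*ˡ es a F) (*-comm a _))

    stateSum-ΣΓ : ∀ {E : Set} {n} (es : List E) (F : Γ n → List E → Carrier) →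
      stateSum es (λ S → ΣΓ (λ 𝒜 → F 𝒜 S)) ≈ ΣΓ (λ 𝒜 → stateSum es (F 𝒜))
    stateSum-ΣΓ []       F = ≈.refl
    stateSum-ΣΓ (e ∷ es) F = begin
      x ⊛ stateSum es (λ S → ΣΓ (λ 𝒜 → F 𝒜 (e ∷ S))) ⊕ y ⊛ stateSum es (λ S → ΣΓ (λ 𝒜 → F 𝒜 S))
        ≈⟨ +-cong (*-congˡ (stateSum-ΣΓ es (λ 𝒜 → F 𝒜 ∘ (e ∷_)))) (*-congˡ (stateSum-ΣΓ es F)) ⟩
      x ⊛ ΣΓ (λ 𝒜 → stateSum es (F 𝒜 ∘ (e ∷_))) ⊕ y ⊛ ΣΓ (λ 𝒜 → stateSum es (F 𝒜))
        ≈⟨ +-cong (*-distribˡ-ΣΓ x (λ 𝒜 → stateSum es (F 𝒜 ∘ (e ∷_)))) (*-distribˡ-ΣΓ y (λ 𝒜 → stateSum es (F 𝒜))) ⟩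
      ΣΓ (λ 𝒜 → x ⊛ stateSum es (F 𝒜 ∘ (e ∷_))) ⊕ ΣΓ (λ 𝒜 → y ⊛ stateSum es (F 𝒜))
        ≈⟨ ΣΓ-distrib-⊕ (λ 𝒜 → x ⊛ stateSum es (F 𝒜 ∘ (e ∷_))) (λ 𝒜 → y ⊛ stateSum es (F 𝒜)) ⟨
      ΣΓ (λ 𝒜 → stateSum (e ∷ es) (F 𝒜)) ∎

    subsets-sum : ∀ {E : Set} (es : List E) (w : List E → Carrier) →
      sumL (map (λ s → w (select es s) ⊛ pow x (countTrue s) ⊛ pow y (countFalse s)) (subsets (length es)))
        ≈ stateSum es w
    subsets-sum []       w = ≈.trans (+-identityʳ _) (≈.trans (*-identityʳ _) (*-identityʳ _))
    subsets-sum (e ∷ es) w = begin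
      sumL (map term (map (true ∷_) ss ++ map (false ∷_) ss))
        ≡⟨ cong sumL (map-++ term (map (true ∷_) ss) _) ⟩
      sumL (map term (map (true ∷_) ss) ++ map term (map (false ∷_) ss))
        ≈⟨ sumL-++ (map term (map (true ∷_) ss)) _ ⟩
      sumL (map term (map (true ∷_) ss)) ⊕ sumL (map term (map (false ∷_) ss))
        ≡⟨ cong₂ _⊕_ (cong sumL (map-∘ ss)) (cong sumL (map-∘ ss)) ⟨
      sumL (map (term ∘ (true ∷_)) ss) ⊕ sumL (map (term ∘ (false ∷_)) ss)
        ≈⟨ +-cong (sumL-map-*ˡ x _ _ (λ s → Solver.solve 4 (λ w c d x → (w Solver.⊕ (x Solver.⊕ c)) Solver.⊕ d Solver.⊜ x Solver.⊕ ((w Solver.⊕ c) Solver.⊕ d)) ≈.refl _ _ _ x) ss)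
                  (sumL-map-*ˡ y _ _ (λ s → Solver.solve 4 (λ w c d y → (w Solver.⊕ c) Solver.⊕ (y Solver.⊕ d) Solver.⊜ y Solver.⊕ ((w Solver.⊕ c) Solver.⊕ d)) ≈.refl _ _ _ y) ss) ⟩
      x ⊛ sumL (map (λ s → w (e ∷ select es s) ⊛ pow x (countTrue s) ⊛ pow y (countFalse s)) ss)
        ⊕ y ⊛ sumL (map (λ s → w (select es s) ⊛ pow x (countTrue s) ⊛ pow y (countFalse s)) ss)
        ≈⟨ +-cong (*-congˡ (subsets-sum es (w ∘ (e ∷_)))) (*-congˡ (subsets-sum es w)) ⟩
      stateSum (e ∷ es) w ∎
      where
      ss : List (Vec.Vec Bool (length es))
      ss = subsets (length es)
      term : Vec.Vec Bool (suc (length es)) → Carrier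
      term s = w (select (e ∷ es) s) ⊛ pow x (countTrue s) ⊛ pow y (countFalse s)

    negami≈stateSum : ∀ {m} (es : Graph m) t → negami es t x y ≈ stateSum es (λ S → pow t (ω S))
    negami≈stateSum es t = subsets-sum es (λ S → pow t (ω S))

    negami-quotient : ∀ {n k} (X : Graph (n + k)) (𝒜 : Γ n) t →
      negami (X / 𝒜) t x y ≈ stateSum X (λ A → pow t (ω (A / 𝒜)))
    negami-quotient X 𝒜 t = ≈.trans (negami≈stateSum (X / 𝒜) t) (≈.reflexive (stateSum-map _ X _))

    stateSum-glue : ∀ n k h (K : Graph (n + k)) (H : Graph (n + h)) F →
      stateSum (glue n k h K H) F ≈ stateSum K (λ A → stateSum H (λ C → F (glue n k h A C)))
    stateSum-glue n k h K H F = begin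
      stateSum (contract K (embK n k h) ++ contract H (embH n k h)) F
        ≡⟨ trans (stateSum-++ (contract K (embK n k h)) _ F) (stateSum-map _ K _) ⟩
      stateSum K (λ A → stateSum (contract H (embH n k h)) (λ S → F (contract A (embK n k h) ++ S)))
        ≈⟨ stateSum-cong K (λ A → ≈.reflexive (stateSum-map _ H _)) ⟩
      stateSum K (λ A → stateSum H (λ C → F (glue n k h A C))) ∎

    stateSum-ΣΓ² : ∀ {E : Set} {n} (es : List E) (F : Γ n → Γ n → List E → Carrier) →
      stateSum es (λ S → ΣΓ (λ 𝒜 → ΣΓ (λ ℬ → F 𝒜 ℬ S))) ≈ ΣΓ (λ 𝒜 → ΣΓ (λ ℬ → stateSum es (F 𝒜 ℬ)))
    stateSum-ΣΓ² es F = ≈.trans (stateSum-ΣΓ es (λ 𝒜 S → ΣΓ (λ ℬ → F 𝒜 ℬ S))) (ΣΓ-cong (λ 𝒜 → stateSum-ΣΓ es (F 𝒜)))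

    stateSum-bilinear : ∀ {E E′ : Set} {n} (es : List E) (fs : List E′) (b : Γ n → Γ n → Carrier)
      (F : Γ n → List E → Carrier) (G : Γ n → List E′ → Carrier) →
      stateSum es (λ S → stateSum fs (λ S′ → ΣΓ (λ 𝒜 → ΣΓ (λ ℬ → (b 𝒜 ℬ ⊛ F 𝒜 S) ⊛ G ℬ S′))))
        ≈ ΣΓ (λ 𝒜 → ΣΓ (λ ℬ → (b 𝒜 ℬ ⊛ stateSum es (F 𝒜)) ⊛ stateSum fs (G ℬ)))
    stateSum-bilinear es fs b F G = begin
      stateSum es (λ S → stateSum fs (λ S′ → ΣΓ (λ 𝒜 → ΣΓ (λ ℬ → (b 𝒜 ℬ ⊛ F 𝒜 S) ⊛ G ℬ S′))))
        ≈⟨ stateSum-cong es (λ S → ≈.trans (stateSum-ΣΓ² fs (λ 𝒜 ℬ S′ → (b 𝒜 ℬ ⊛ F 𝒜 S) ⊛ G ℬ S′))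
             (ΣΓ-cong (λ 𝒜 → ΣΓ-cong (λ ℬ → stateSum-*ˡ fs (b 𝒜 ℬ ⊛ F 𝒜 S) (G ℬ))))) ⟩
      stateSum es (λ S → ΣΓ (λ 𝒜 → ΣΓ (λ ℬ → (b 𝒜 ℬ ⊛ F 𝒜 S) ⊛ stateSum fs (G ℬ))))
        ≈⟨ stateSum-ΣΓ² es (λ 𝒜 ℬ S → (b 𝒜 ℬ ⊛ F 𝒜 S) ⊛ stateSum fs (G ℬ)) ⟩
      ΣΓ (λ 𝒜 → ΣΓ (λ ℬ → stateSum es (λ S → (b 𝒜 ℬ ⊛ F 𝒜 S) ⊛ stateSum fs (G ℬ))))
        ≈⟨ ΣΓ-cong (λ 𝒜 → ΣΓ-cong (λ ℬ → ≈.trans (stateSum-*ʳ es _ _) (*-congʳ (stateSum-*ˡ es (b 𝒜 ℬ) (F 𝒜))))) ⟩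
      ΣΓ (λ 𝒜 → ΣΓ (λ ℬ → (b 𝒜 ℬ ⊛ stateSum es (F 𝒜)) ⊛ stateSum fs (G ℬ))) ∎

  weight-glue : ∀ n k h t (B : Γ n → Γ n → Carrier) →
    (∀ 𝒜 ℬ → triple (Tₙ n t) B (Tₙ n t) 𝒜 ℬ ≈ Tₙ n t 𝒜 ℬ) →
    (A : Graph (n + k)) (C : Graph (n + h)) →
    pow t (ω (glue n k h A C)) ≈ ΣΓ (λ 𝒜 → ΣΓ (λ ℬ → (B 𝒜 ℬ ⊛ pow t (ω (A / 𝒜))) ⊛ pow t (ω (C / ℬ))))
  weight-glue n k h t B TBT≈T A C = begin
    pow t (ω (glue n k h A C))
      ≡⟨ cong (pow t) (Gluing.ω-glue n k h A C) ⟩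
    pow t (meetSize πA πC + (dA + dC))
      ≈⟨ pow-+ t (meetSize πA πC) (dA + dC) ⟩
    pow t (meetSize πA πC) ⊛ pow t (dA + dC)
      ≈⟨ *-congʳ (TBT≈T πA πC) ⟨
    triple (Tₙ n t) B (Tₙ n t) πA πC ⊛ pow t (dA + dC)
      ≈⟨ *-distribʳ-ΣΓ (pow t (dA + dC)) (λ 𝒜 → ΣΓ (λ ℬ → (Tₙ n t πA 𝒜 ⊛ B 𝒜 ℬ) ⊛ Tₙ n t ℬ πC)) ⟩
    ΣΓ (λ 𝒜 → ΣΓ (λ ℬ → (Tₙ n t πA 𝒜 ⊛ B 𝒜 ℬ) ⊛ Tₙ n t ℬ πC) ⊛ pow t (dA + dC))
      ≈⟨ ΣΓ-cong (λ 𝒜 → *-distribʳ-ΣΓ (pow t (dA + dC)) (λ ℬ → (Tₙ n t πA 𝒜 ⊛ B 𝒜 ℬ) ⊛ Tₙ n t ℬ πC)) ⟩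
    ΣΓ (λ 𝒜 → ΣΓ (λ ℬ → ((Tₙ n t πA 𝒜 ⊛ B 𝒜 ℬ) ⊛ Tₙ n t ℬ πC) ⊛ pow t (dA + dC)))
      ≈⟨ ΣΓ-cong (λ 𝒜 → ΣΓ-cong (λ ℬ → summand 𝒜 ℬ)) ⟩
    ΣΓ (λ 𝒜 → ΣΓ (λ ℬ → (B 𝒜 ℬ ⊛ pow t (ω (A / 𝒜))) ⊛ pow t (ω (C / ℬ)))) ∎
    where
    πA πC : Γ n
    πA = Boundary.partition n k A
    πC = Boundary.partition n h C
    dA dC : ℕ
    dA = Boundary.detached n k A
    dC = Boundary.detached n h C
    summand : ∀ 𝒜 ℬ → ((Tₙ n t πA 𝒜 ⊛ B 𝒜 ℬ) ⊛ Tₙ n t ℬ πC) ⊛ pow t (dA + dC)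
                     ≈ (B 𝒜 ℬ ⊛ pow t (ω (A / 𝒜))) ⊛ pow t (ω (C / ℬ))
    summand 𝒜 ℬ = begin
      ((pow t (meetSize πA 𝒜) ⊛ B 𝒜 ℬ) ⊛ pow t (meetSize ℬ πC)) ⊛ pow t (dA + dC)
        ≈⟨ *-congˡ (pow-+ t dA dC) ⟩
      ((pow t (meetSize πA 𝒜) ⊛ B 𝒜 ℬ) ⊛ pow t (meetSize ℬ πC)) ⊛ (pow t dA ⊛ pow t dC)
        ≈⟨ Solver.solve 5 (λ p b q r s → ((p Solver.⊕ b) Solver.⊕ q) Solver.⊕ (r Solver.⊕ s)
                                         Solver.⊜ (b Solver.⊕ (p Solver.⊕ r)) Solver.⊕ (q Solver.⊕ s)) ≈.refl _ _ _ _ _ ⟩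
      (B 𝒜 ℬ ⊛ (pow t (meetSize πA 𝒜) ⊛ pow t dA)) ⊛ (pow t (meetSize ℬ πC) ⊛ pow t dC)
        ≈⟨ *-cong (*-congˡ (pow-+ t (meetSize πA 𝒜) dA)) (pow-+ t (meetSize ℬ πC) dC) ⟨
      (B 𝒜 ℬ ⊛ pow t (meetSize πA 𝒜 + dA)) ⊛ pow t (meetSize ℬ πC + dC)
        ≡⟨ cong₂ (λ u v → (B 𝒜 ℬ ⊛ pow t u) ⊛ pow t v)
             (Boundary.Quotient.ω-quotient n k A 𝒜)
             (trans (Boundary.Quotient.ω-quotient n h C ℬ) (cong (_+ dC) (meetSize-comm πC ℬ))) ⟨
      (B 𝒜 ℬ ⊛ pow t (ω (A / 𝒜))) ⊛ pow t (ω (C / ℬ)) ∎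

theorem1 : ∀ {c ℓ} (R : CommutativeRing c ℓ) (n k h : ℕ)
  (K : Graph (n + k)) (H : Graph (n + h))
  (t : CommutativeRing.Carrier R)
  (B : Γ n → Γ n → CommutativeRing.Carrier R) →
  (∀ 𝒜 ℬ → CommutativeRing._≈_ R (Poly.triple R (Poly.T R n t) B (Poly.T R n t) 𝒜 ℬ) (Poly.T R n t 𝒜 ℬ)) →
  ∀ x y → CommutativeRing._≈_ R (Poly.negami R (glue n k h K H) t x y)
    (Poly.ΣΓ R (λ 𝒜 → Poly.ΣΓ R (λ ℬ → CommutativeRing._*_ R (CommutativeRing._*_ R (B 𝒜 ℬ) (Poly.negami R (K / 𝒜) t x y)) (Poly.negami R (H / ℬ) t x y))))
theorem1 R n k h K H t B TBT≈T x y = begin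
  negami (glue n k h K H) t x y
    ≈⟨ negami≈stateSum (glue n k h K H) t ⟩
  stateSum (glue n k h K H) (λ S → pow t (ω S))
    ≈⟨ stateSum-glue n k h K H _ ⟩
  stateSum K (λ A → stateSum H (λ C → pow t (ω (glue n k h A C))))
    ≈⟨ stateSum-cong K (λ A → stateSum-cong H (weight-glue n k h t B TBT≈T A)) ⟩
  stateSum K (λ A → stateSum H (λ C → ΣΓ (λ 𝒜 → ΣΓ (λ ℬ → (B 𝒜 ℬ ⊛ pow t (ω (A / 𝒜))) ⊛ pow t (ω (C / ℬ))))))
    ≈⟨ stateSum-bilinear K H B (λ 𝒜 A → pow t (ω (A / 𝒜))) (λ ℬ C → pow t (ω (C / ℬ))) ⟩
  ΣΓ (λ 𝒜 → ΣΓ (λ ℬ → (B 𝒜 ℬ ⊛ stateSum K (λ A → pow t (ω (A / 𝒜)))) ⊛ stateSum H (λ C → pow t (ω (C / ℬ)))))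
    ≈⟨ ΣΓ-cong (λ 𝒜 → ΣΓ-cong (λ ℬ → *-cong (*-congˡ {B 𝒜 ℬ} (negami-quotient K 𝒜 t)) (negami-quotient H ℬ t))) ⟨
  ΣΓ (λ 𝒜 → ΣΓ (λ ℬ → (B 𝒜 ℬ ⊛ negami (K / 𝒜) t x y) ⊛ negami (H / ℬ) t x y)) ∎
  where
  open CommutativeRing R using (_≈_; setoid; *-cong; *-congˡ) renaming (_*_ to _⊛_)
  open Poly R using (pow; ΣΓ; negami)
  open SetoidReasoning setoid
  open Expansion R
  open StateSum x y
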